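{- Let $n\ge r\ge0$, $R\in\mathrm{RAT}^+(n+1,r+1)$, $\pi=\Phi_I(R)\in\mathcal{A}(n+1,r+1)$, and $v=e(\pi)$. For $i\in[n+1]\setminus\{1\}$: strip $i$ of $R$ is a diagonal strip iff $i$ is a special descent of $v$; strip $i$ is a horizontal strip (row) iff $i$ is an ascent of $v$; strip $i$ is a vertical strip (column) iff $i$ is a regular descent of $v$. Moreover, the labels of the free rows of $R$ are exactly the right-to-left minima of $v$ other than $\epsilon_1,\dots,\epsilon_{r+1}$.
   Context: Rhombic diagrams and RAT. For $w=w_1\cdots w_m\in\{0,1,2\}^m$, the rhombic diagram $\Gamma_w$ is the region between the southeast border (reading $w$ left to right: a unit step south for $2$, southwest (vector $(-1,-1)$) for $1$, west for $0$) and the northwest border from the same start ((number of $0$'s) steps west, then (number of $1$'s) southwest, then (number of $2$'s) south), tiled by squares, tall rhombi and short rhombi via the maximal tiling (if no $i$ has $w_i>w_{i+1}$ nothing is tiled; otherwise for the smallest such $i$, tile the region of the word with $w_i,w_{i+1}$ swapped and add a tall rhombus, square or short rhombus according as $(w_i,w_{i+1})=(2,1),(2,0),(1,0)$). Border edges are labeled $1,\dots,m$ from northeast to southwest; each starts a strip (maximal sequence of tiles connected through parallel edges) with its label: horizontal strips (rows) from vertical edges, vertical strips (columns) from horizontal edges, diagonal strips from diagonal edges; for $i<j$ the cell $(i,j)$ is the tile in strips $i,j$. A RAT is a filling of some tiles with up-arrows (only in tiles of a column) and left-arrows (only in tiles of a row) such that no arrow lies in a cell pointed to by another arrow; a left-arrow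 points to all other cells of its row to its west, an up-arrow to all other cells of its column to its north. A free row has no left-arrow. $\mathrm{RAT}^+(n+1,r+1)$: RAT labeled by $[n+1]$ with $r+1$ diagonal steps, first step diagonal, every column containing an up-arrow. Assemblées and $\epsilon$-words. $\mathcal{A}(n+1,r+1)$ is the set of sets of $r+1$ permutations (words) of the blocks of a set partition of $[n+1]$ into $r+1$ blocks. Fix symbols $\epsilon_1<\cdots<\epsilon_{r+1}<1<2<\cdots<n+1$. For $\pi\in\mathcal{A}(n+1,r+1)$ order its blocks $B_1,\dots,B_{r+1}$ with $1\in B_1$ and the last letters $d_2<\cdots<d_{r+1}$ of $B_2,\dots,B_{r+1}$ increasing; write $B_1=C_1\,1\,C_2$; the $\epsilon$-word is $e(\pi)=C_1\,1\,\epsilon_1\,B_2\,\epsilon_2\cdots B_{r+1}\,\epsilon_{r+1}\,C_2$. Conversely, for such a word $v=B_1\epsilon_1B_2\epsilon_2\cdots B_{r+1}\epsilon_{r+1}B_{r+2}$, $e^{ -1}(v)$ is the assemblée with blocks $B_1B_{r+2}$ (concatenation), $B_2,\dots,B_{r+1}$. For $v$, an integer $i$ is an ascent if it is followed by a larger letter or is last; a descent if followed by a smaller letter; a descent is special if followed by some $\epsilon_j$, regular otherwise. A letter is a right-to-left minimum if it is smaller than all letters to its right. Insertion map $\Phi_I$. For $R\in\mathrm{RAT}^+(n+1,r+1)$ with diagonal labels $1=d_1<\cdots<d_{r+1}$ and free row labels $a_1<\cdots<a_t$, start with $v=\epsilon_1\cdots\epsilon_{r+1}a_1\cdots a_t$.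 Process the column and diagonal strips in decreasing order of label: for strip $\ell$, let $r_1<\cdots<r_k$ be the labels of the strips meeting strip $\ell$ in a cell containing a left-arrow; let $j=h$ if $\ell$ is a column with its up-arrow in row $h$, $j=\epsilon_t$ if $\ell$ is a column with its up-arrow in diagonal strip $d_t$, and $j=\epsilon_t$ if $\ell=d_t$; insert $r_1\cdots r_k\,\ell$ immediately to the left of $j$ in $v$. Finally $\Phi_I(R)=e^{ -1}(v)$ (so $e(\Phi_I(R))=v$). -}

module Defs where

open import Data.Nat using (ℕ; zero; suc; _*_; _<_; _<ᵇ_; _≤?_)
open import Data.Fin using (Fin; toℕ)
open import Data.Vec using (Vec; lookup)
import Data.Vec as V
open import Data.List using (List; []; _∷_; _++_; map; filterᵇ; reverse; length; upTo; allFin; foldl; head; [_])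
open import Data.Bool.ListAction using (and)
open import Data.Bool using (Bool; true; false; if_then_else_; _∧_; not)
open import Data.Maybe using (Maybe; just; nothing; maybe)
import Data.Maybe as M
open import Data.Product using (_×_; _,_; proj₁; proj₂; ∃; ∃-syntax)
open import Data.Sum using (_⊎_)
open import Relation.Nullary using (Dec; yes; no; ¬_)
open import Relation.Nullary.Decidable using (isYes)
open import Relation.Binary.PropositionalEquality using (_≡_; refl; _≢_)
open import Data.List.Membership.Propositional using (_∈_)
open import Data.List.Relation.Unary.All using (All)
import Data.Nat.Properties as ℕP

-- Letters of the word w ∈ {0,1,2}^m
--   L0 : west step  (horizontal border edge, starts a column)
--   L1 : southwest step (diagonal border edge, starts a diagonal strip)
--   L2 : south step (vertical border edge, starts a row)

data Letter : Set where
  L0 L1 L2 : Letter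

rank : Letter → ℕ
rank L0 = 0
rank L1 = 1
rank L2 = 2

_≟L_ : (a b : Letter) → Dec (a ≡ b)
L0 ≟L L0 = yes refl
L0 ≟L L1 = no λ ()
L0 ≟L L2 = no λ ()
L1 ≟L L0 = no λ ()
L1 ≟L L1 = yes refl
L1 ≟L L2 = no λ ()
L2 ≟L L0 = no λ ()
L2 ≟L L1 = no λ ()
L2 ≟L L2 = yes refl

countDiag : ∀ {m} → Vec Letter m → ℕ
countDiag V.[] = 0
countDiag (L1 V.∷ xs) = suc (countDiag xs)
countDiag (_ V.∷ xs) = countDiag xs

label : ∀ {m} → Fin m → ℕ
label i = suc (toℕ i)

-- The maximal tiling, recorded as the sequence of tiles (i , j) (labels
-- of the two strips, i < j) in the order in which they are added by the
-- recursive construction: at each stage swap the leftmost adjacent pair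
-- with w_p > w_{p+1}.  Each tile added later lies further from the
-- southeast border along each of its two strips, so the order of the
-- tiles of a strip in this sequence is their order along the strip,
-- starting at the southeast border edge (rows run west, columns north).

module Tiling {m : ℕ} (w : Vec Letter m) where

  val : Fin m → ℕ
  val i = rank (lookup w i)

  leftSwapFrom : Fin m → List (Fin m) → Maybe ((Fin m × Fin m) × List (Fin m))
  leftSwapFrom a [] = nothing
  leftSwapFrom a (b ∷ xs) with val b <ᵇ val a
  ... | true  = just ((a , b) , b ∷ a ∷ xs)
  ... | false = M.map (λ q → proj₁ q , a ∷ proj₂ q) (leftSwapFrom b xs)

  leftSwap : List (Fin m) → Maybe ((Fin m × Fin m) × List (Fin m))
  leftSwap [] = nothing
  leftSwap (a ∷ xs) = leftSwapFrom a xs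

  -- fuel: each swap removes one inversion, and there are < m*m inversions
  bubble : ℕ → List (Fin m) → List (Fin m × Fin m)
  bubble zero xs = []
  bubble (suc f) xs with leftSwap xs
  ... | nothing = []
  ... | just (p , ys) = p ∷ bubble f ys

  tiles : List (Fin m × Fin m)
  tiles = bubble (m * m) (allFin m)

open Tiling public using (tiles)

Before : ∀ {A : Set} → List A → A → A → Set
Before {A} l c c' = ∃[ xs ] ∃[ ys ] ∃[ zs ] (l ≡ xs ++ c ∷ ys ++ c' ∷ zs)

data Arrow : Set where
  none up left : Arrow

_≟A_ : (a b : Arrow) → Dec (a ≡ b)
none ≟A none = yes refl
none ≟A up = no λ ()
none ≟A left = no λ ()
up ≟A none = no λ ()
up ≟A up = yes refl
up ≟A left = no λ ()
left ≟A none = no λ ()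
left ≟A up = no λ ()
left ≟A left = yes refl

-- fill i j is the content of cell (i , j) (strips with labels i+1, j+1)
record RATplus (n r : ℕ) : Set where
  field
    w    : Vec Letter (suc n)
    fill : Fin (suc n) → Fin (suc n) → Arrow
    firstDiag : lookup w Data.Fin.zero ≡ L1
    diagCount : countDiag w ≡ suc r
    upValid   : ∀ i j → fill i j ≡ up → (i , j) ∈ tiles w × lookup w j ≡ L0
    leftValid : ∀ i j → fill i j ≡ left → (i , j) ∈ tiles w × lookup w i ≡ L2
    -- no arrow in a cell pointed to by a left-arrow (cells further west in its row)
    leftPoint : ∀ i j j' → fill i j ≡ left → Before (tiles w) (i , j) (i , j') → fill i j' ≡ none
    -- no arrow in a cell pointed to by an up-arrow (cells further north in its column)
    upPoint   : ∀ i i' j → fill i j ≡ up → Before (tiles w) (i , j) (i' , j) → fill i' j ≡ none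
    colHasUp  : ∀ j → lookup w j ≡ L0 → ∃[ i ] (fill i j ≡ up)

FreeRow : ∀ {n r} → RATplus n r → Fin (suc n) → Set
FreeRow R i = lookup (RATplus.w R) i ≡ L2 × (∀ j → RATplus.fill R i j ≢ left)

data Sym : Set where
  eps : ℕ → Sym
  num : ℕ → Sym

data _<ˢ_ : Sym → Sym → Set where
  ee : ∀ {a b} → a < b → eps a <ˢ eps b
  en : ∀ {a b} → eps a <ˢ num b
  nn : ∀ {a b} → a < b → num a <ˢ num b

_≟S_ : (a b : Sym) → Dec (a ≡ b)
eps a ≟S eps b with a ℕP.≟ b
... | yes refl = yes refl
... | no ne = no λ { refl → ne refl }
eps a ≟S num b = no λ ()
num a ≟S eps b = no λ ()
num a ≟S num b with a ℕP.≟ b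
... | yes refl = yes refl
... | no ne = no λ { refl → ne refl }

IsEps : Sym → Set
IsEps s = ∃[ t ] (s ≡ eps t)

Ascent : List Sym → ℕ → Set
Ascent v i = ∃[ xs ] ∃[ ys ] (v ≡ xs ++ num i ∷ ys ×
               (ys ≡ [] ⊎ ∃[ y ] ∃[ zs ] (ys ≡ y ∷ zs × num i <ˢ y)))

Descent : List Sym → ℕ → Set
Descent v i = ∃[ xs ] ∃[ y ] ∃[ zs ] (v ≡ xs ++ num i ∷ y ∷ zs × y <ˢ num i)

SpecialDescent : List Sym → ℕ → Set
SpecialDescent v i = ∃[ xs ] ∃[ y ] ∃[ zs ]
  (v ≡ xs ++ num i ∷ y ∷ zs × y <ˢ num i × IsEps y)

RegularDescent : List Sym → ℕ → Set
RegularDescent v i = ∃[ xs ] ∃[ y ] ∃[ zs ]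
  (v ≡ xs ++ num i ∷ y ∷ zs × y <ˢ num i × ¬ IsEps y)

RLMin : List Sym → Sym → Set
RLMin v x = ∃[ xs ] ∃[ ys ] (v ≡ xs ++ x ∷ ys × All (x <ˢ_) ys)

insertBefore : Sym → List Sym → List Sym → List Sym
insertBefore t blk [] = []
insertBefore t blk (x ∷ xs) with x ≟S t
... | yes _ = blk ++ x ∷ xs
... | no _  = x ∷ insertBefore t blk xs

module Insertion {n r : ℕ} (R : RATplus n r) where
  open RATplus R

  -- diagIndex h = t  such that h is the diagonal label d_t (d_1 < d_2 < ...)
  diagIndex : Fin (suc n) → ℕ
  diagIndex h = length (filterᵇ (λ k → isYes (toℕ k ≤? toℕ h) ∧ isYes (lookup w k ≟L L1))
                                (allFin (suc n)))

  freeB : Fin (suc n) → Bool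
  freeB i = isYes (lookup w i ≟L L2) ∧ and (map (λ j → not (isYes (fill i j ≟A left))) (allFin (suc n)))

  initWord : List Sym
  initWord = map (λ t → eps (suc t)) (upTo (suc r))
             ++ map (λ i → num (label i)) (filterᵇ freeB (allFin (suc n)))

  leftLabels : Fin (suc n) → List Sym
  leftLabels ℓ = map (λ i → num (label i))
                     (filterᵇ (λ i → isYes (fill i ℓ ≟A left)) (allFin (suc n)))

  firstUp : Fin (suc n) → Maybe (Fin (suc n))
  firstUp ℓ = head (filterᵇ (λ h → isYes (fill h ℓ ≟A up)) (allFin (suc n)))

  upTarget : Fin (suc n) → Sym
  upTarget h with lookup w h
  ... | L2 = num (label h)
  ... | _  = eps (diagIndex h)

  target : Fin (suc n) → Maybe Sym
  target ℓ with lookup w ℓ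
  ... | L1 = just (eps (diagIndex ℓ))
  ... | L0 = M.map upTarget (firstUp ℓ)
  ... | L2 = nothing

  step : List Sym → Fin (suc n) → List Sym
  step v ℓ = maybe (λ t → insertBefore t (leftLabels ℓ ++ [ num (label ℓ) ]) v) v (target ℓ)

  processed : List (Fin (suc n))
  processed = filterᵇ (λ ℓ → not (isYes (lookup w ℓ ≟L L2))) (reverse (allFin (suc n)))

  word : List Sym
  word = foldl step initWord processed

-- v = e(Φ_I(R))
phiWord : ∀ {n r} → RATplus n r → List Sym
phiWord R = Insertion.word R

-- The maximal tiling is the list of swaps made by bubble sort that always swaps the leftmost
-- descent, which is insertion sort.  Hence the cells of a row are met from east to west in
-- increasing column label, and the cells of a column from south to north in decreasing row label.
-- With the RAT conditions this gives the local picture: a row has at most one left-arrow, lying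
-- west of the up-arrows of that row, and the up-arrow of a column lies north of the left-arrows
-- of that column whenever it sits in a row.
--
-- Inserting the column and diagonal strips by decreasing label then preserves an invariant of
-- the partial ε-word: a processed diagonal d is immediately followed by the ε of d; a processed
-- column is immediately followed by a smaller integer or by the ε of a diagonal not processed
-- yet; an inserted row label is last or followed by a larger integer; free rows are
-- right-to-left minima; a row with a left-arrow in a processed column is followed somewhere by a
-- letter not above it.  Since every letter occurs exactly once, these facts pin down the type of
-- every letter of the final word.

module Submission where

open import Defs
open import Data.Nat using (ℕ; zero; suc; _+_; _<_; _≤_; z≤n; s≤s; _<ᵇ_; _<?_; _≤?_)
open import Data.Nat.Properties
open import Data.Fin using (Fin; toℕ)
import Data.Fin as F
import Data.Fin.Properties as F
open import Data.Vec using (Vec; lookup)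
import Data.Vec as V
open import Data.List
  using (List; []; _∷_; _++_; _∷ʳ_; map; filterᵇ; length; allFin; tabulate; head; upTo; foldl; foldr; reverse;
         initLast; _∷ʳ′_)
open import Data.List.Properties using (++-assoc; ++-identityʳ; ∷-injective; ∷ʳ-injective; reverse-foldl)
open import Data.List.Relation.Unary.All using (All; []; _∷_)
import Data.List.Relation.Unary.All as All
import Data.List.Relation.Unary.All.Properties as All
open import Data.List.Relation.Unary.AllPairs using (AllPairs; []; _∷_)
import Data.List.Relation.Unary.AllPairs as AllPairs
import Data.List.Relation.Unary.AllPairs.Properties as AllPairs
open import Data.List.Relation.Unary.Unique.Propositional using (Unique)
open import Data.List.Relation.Unary.Any using (here; there)
open import Data.List.Membership.Propositional using (_∈_; _∉_)
open import Data.List.Membership.Propositional.Properties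
  using (∈-++⁺ˡ; ∈-++⁺ʳ; ∈-++⁻; ∈-∃++; ∈-map⁺; ∈-map⁻; ∈-filter⁺; ∈-filter⁻; ∈-allFin; ∈-upTo⁺; ∈-upTo⁻)
open import Data.List.Relation.Binary.Subset.Propositional using (_⊆_)
open import Data.Bool using (Bool; true; false; T; _∧_; not)
open import Data.Maybe using (just; nothing)
import Data.Maybe as Maybe
open import Data.Product using (_×_; _,_; proj₁; proj₂; ∃-syntax; Σ)
open import Data.Sum using (_⊎_; inj₁; inj₂)
import Data.Sum as Sum
open import Data.Empty using (⊥-elim)
open import Data.Unit using (tt)
open import Function using (_∘_)
open import Function.Bundles using (_⇔_; mk⇔)
open import Relation.Binary.PropositionalEquality
open import Relation.Binary.Definitions using (tri<; tri≈; tri>)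
open import Relation.Nullary using (¬_; Dec; yes; no; contradiction)
open import Relation.Nullary.Decidable using (isYes; T?; toWitness; fromWitness; toWitnessFalse)

-- The maximal tiling as insertion sort

≤⇒<ᵇ≡false : ∀ {m n} → n ≤ m → (m <ᵇ n) ≡ false
≤⇒<ᵇ≡false {m} {n} n≤m with m <ᵇ n | <ᵇ⇒< m n
... | true  | m<n = ⊥-elim (<⇒≱ (m<n tt) n≤m)
... | false | _   = refl

<⇒<ᵇ≡true : ∀ {m n} → m < n → (m <ᵇ n) ≡ true
<⇒<ᵇ≡true {m} {n} m<n with m <ᵇ n | <⇒<ᵇ {m} {n}
... | true  | _    = refl
... | false | m<ᵇn = ⊥-elim (m<ᵇn m<n)

Before-∷ : ∀ {A : Set} {l : List A} {c c'} x → Before l c c' → Before (x ∷ l) c c'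
Before-∷ x (xs , ys , zs , eq) = x ∷ xs , ys , zs , cong (x ∷_) eq

Before-here : ∀ {A : Set} {l : List A} {c c'} → c' ∈ l → Before (c ∷ l) c c'
Before-here {c = c} c'∈l with ∈-∃++ c'∈l
... | ys , zs , eq = [] , ys , zs , cong (c ∷_) eq

module _ {A : Set} {R : A → A → Set} where

  AllPairs-++⁻ˡ : ∀ xs {ys} → AllPairs R (xs ++ ys) → AllPairs R xs
  AllPairs-++⁻ˡ []       _          = []
  AllPairs-++⁻ˡ (x ∷ xs) (px ∷ pxs) = All.++⁻ˡ xs px ∷ AllPairs-++⁻ˡ xs pxs

  AllPairs-∷ʳ⁺ : ∀ {xs u} → AllPairs R xs → All (λ y → R y u) xs → AllPairs R (xs ∷ʳ u)
  AllPairs-∷ʳ⁺ pxs Rxsu = AllPairs.++⁺ pxs ([] ∷ []) (All.map (_∷ []) Rxsu)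

  AllPairs-insert⁺ : ∀ xs {ys u} → AllPairs R (xs ++ ys) → All (λ y → R y u) xs → All (R u) ys →
                     AllPairs R (xs ++ u ∷ ys)
  AllPairs-insert⁺ []       pys        []         Ruys = Ruys ∷ pys
  AllPairs-insert⁺ (x ∷ xs) (px ∷ pxs) (Rxu ∷ Rxsu) Ruys =
    All.++⁺ (All.++⁻ˡ xs px) (Rxu ∷ All.++⁻ʳ xs px) ∷ AllPairs-insert⁺ xs pxs Rxsu Ruys

  AllPairs-middle : ∀ xs {a ys x} → AllPairs R (xs ++ a ∷ ys) → x ∈ xs → R x a
  AllPairs-middle (_ ∷ xs) (px ∷ _)  (here refl) = All.lookup px (∈-++⁺ʳ xs (here refl))
  AllPairs-middle (_ ∷ xs) (_ ∷ pxs) (there x∈xs) = AllPairs-middle xs pxs x∈xs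

-- A state of `bubble` is prefix ++ key ∷ passed ++ rest, where key moves left through the
-- sorted prefix ++ passed and rest is still untouched.
module TilingOrder {m : ℕ} (w : Vec Letter m) where
  open Tiling w using (val; leftSwapFrom; leftSwap; bubble)

  _≺_ : Fin m → Fin m → Set
  x ≺ y = val x < val y ⊎ (val x ≡ val y × x F.< y)

  ≺⇒≤ : ∀ {x y} → x ≺ y → val x ≤ val y
  ≺⇒≤ (inj₁ x<y)       = <⇒≤ x<y
  ≺⇒≤ (inj₂ (x≡y , _)) = ≤-reflexive x≡y

  ≤∧<⇒≺ : ∀ {x y} → val x ≤ val y → x F.< y → x ≺ y
  ≤∧<⇒≺ x≤y x<y with m≤n⇒m<n∨m≡n x≤y
  ... | inj₁ v<v = inj₁ v<v
  ... | inj₂ v≡v = inj₂ (v≡v , x<y)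

  record SortState (ys : List (Fin m)) : Set where
    constructor sortState
    field
      prefix passed rest : List (Fin m)
      key               : Fin m
      shape             : ys ≡ prefix ++ key ∷ passed ++ rest
      sorted            : AllPairs _≺_ (prefix ++ passed)
      passed-above      : All (λ x → val key < val x) passed
      key-greatest      : All (F._< key) (prefix ++ passed)
      rest-increasing   : AllPairs F._<_ (key ∷ rest)
  open SortState

  key<rest : ∀ {ys} (D : SortState ys) {y} → y ∈ rest D → key D F.< y
  key<rest D y∈rest with rest-increasing D
  ... | key<rest ∷ _ = All.lookup key<rest y∈rest

  leftSwapFrom-sorted : ∀ y L → AllPairs _≺_ (y ∷ L) → leftSwapFrom y L ≡ nothing
  leftSwapFrom-sorted y []      _ = refl
  leftSwapFrom-sorted y (b ∷ L) ((y≺b ∷ _) ∷ sorted)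
    rewrite ≤⇒<ᵇ≡false {val b} {val y} (≺⇒≤ y≺b) | leftSwapFrom-sorted b L sorted = refl

  leftSwap-sorted : ∀ L → AllPairs _≺_ L → leftSwap L ≡ nothing
  leftSwap-sorted []      _      = refl
  leftSwap-sorted (y ∷ L) sorted = leftSwapFrom-sorted y L sorted

  leftSwapFrom-descent : ∀ y Q x u R → AllPairs _≺_ (y ∷ Q ∷ʳ x) → val u < val x →
    leftSwapFrom y (Q ++ x ∷ u ∷ R) ≡ just ((x , u) , y ∷ Q ++ u ∷ x ∷ R)
  leftSwapFrom-descent y [] x u R ((y≺x ∷ _) ∷ _) u<x
    rewrite ≤⇒<ᵇ≡false {val x} {val y} (≺⇒≤ y≺x) | <⇒<ᵇ≡true u<x = refl
  leftSwapFrom-descent y (b ∷ Q) x u R ((y≺b ∷ _) ∷ sorted) u<x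
    rewrite ≤⇒<ᵇ≡false {val b} {val y} (≺⇒≤ y≺b) | leftSwapFrom-descent b Q x u R sorted u<x = refl

  leftSwap-descent : ∀ Q x u R → AllPairs _≺_ (Q ∷ʳ x) → val u < val x →
    leftSwap (Q ++ x ∷ u ∷ R) ≡ just ((x , u) , Q ++ u ∷ x ∷ R)
  leftSwap-descent []      x u R _      u<x rewrite <⇒<ᵇ≡true u<x = refl
  leftSwap-descent (y ∷ Q) x u R sorted u<x = leftSwapFrom-descent y Q x u R sorted u<x

  sorted-last-greatest : ∀ Q x → AllPairs _≺_ (Q ∷ʳ x) → All (λ y → val y ≤ val x) (Q ∷ʳ x)
  sorted-last-greatest []      x _ = ≤-refl ∷ []
  sorted-last-greatest (y ∷ Q) x (y≺ ∷ sorted) =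
    ≺⇒≤ (All.lookup y≺ (∈-++⁺ʳ Q (here refl))) ∷ sorted-last-greatest Q x sorted

  -- Either bubble stops at ys, or it records the swap (a , key D') and continues from a state D'.
  Step : List (Fin m) → (Fin m → ∀ {ys'} → SortState ys' → Set) → Set
  Step ys Rel = leftSwap ys ≡ nothing ⊎
    Σ (Fin m) λ a → Σ (List (Fin m)) λ ys' → Σ (SortState ys') λ D' →
      leftSwap ys ≡ just ((a , key D') , ys') × (∃[ B' ] (passed D' ≡ a ∷ B')) × Rel a D'

  NewKeyFrom : List (Fin m) → Fin m → ∀ {ys'} → SortState ys' → Set
  NewKeyFrom U _ D' = key D' ∷ rest D' ⊆ U

  step-in-rest : ∀ Q x U → AllPairs _≺_ (Q ∷ʳ x) → All (λ u → All (F._< u) (Q ∷ʳ x)) U →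
    AllPairs F._<_ U → Step ((Q ∷ʳ x) ++ U) (NewKeyFrom U)
  step-in-rest Q x [] sorted _ _ =
    inj₁ (subst (λ z → leftSwap z ≡ nothing) (sym (++-identityʳ (Q ∷ʳ x))) (leftSwap-sorted _ sorted))
  step-in-rest Q x (u ∷ U) sorted (Q<u ∷ Q<U) (u<U ∷ U-inc) with val u <? val x
  ... | yes u<x = inj₂ (x , Q ++ u ∷ x ∷ U , D' ,
          trans (cong leftSwap (++-assoc Q (x ∷ []) (u ∷ U))) (leftSwap-descent Q x u U sorted u<x) ,
          (_ , refl) , λ { (here refl) → here refl ; (there z∈U) → there z∈U })
    where
    Qx≡ : Q ∷ʳ x ≡ (Q ++ x ∷ []) ++ []
    Qx≡ = sym (++-identityʳ _)
    D' : SortState (Q ++ u ∷ x ∷ U)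
    D' = sortState Q (x ∷ []) U u refl
           (subst (AllPairs _≺_) (++-assoc Q (x ∷ []) []) (subst (AllPairs _≺_) Qx≡ sorted))
           (u<x ∷ []) (subst (All (F._< u)) (trans Qx≡ (++-assoc Q (x ∷ []) [])) Q<u) (u<U ∷ U-inc)
  ... | no u≮x = Sum.map (subst (λ z → leftSwap z ≡ nothing) Qxu≡)
                   (λ { (a , ys' , D' , e , b , s) →
                        a , ys' , D' , trans (cong leftSwap (sym Qxu≡)) e , b , λ z∈ → there (s z∈) })
                   (step-in-rest (Q ∷ʳ x) u U sorted'
                      (All.zipWith (λ { (u<v , Q<v) → All.++⁺ Q<v (u<v ∷ []) }) (u<U , Q<U)) U-inc)
    where
    Qxu≡ : ((Q ∷ʳ x) ∷ʳ u) ++ U ≡ (Q ∷ʳ x) ++ u ∷ U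
    Qxu≡ = ++-assoc (Q ∷ʳ x) (u ∷ []) U
    sorted' : AllPairs _≺_ ((Q ∷ʳ x) ∷ʳ u)
    sorted' = AllPairs-∷ʳ⁺ sorted
      (All.zipWith (λ { (y≤x , y<u) → ≤∧<⇒≺ (≤-trans y≤x (≮⇒≥ u≮x)) y<u }) (sorted-last-greatest Q x sorted , Q<u))

  step-after-key : ∀ A j B U → AllPairs _≺_ (A ++ B) → All (λ x → val j < val x) B →
    All (F._< j) (A ++ B) → AllPairs F._<_ (j ∷ U) → All (λ x → val x ≤ val j) A →
    Step (A ++ j ∷ B ++ U) (NewKeyFrom U)
  step-after-key A j B U sorted B-above AB<j (j<U ∷ U-inc) A≤j =
    subst (λ z → Step z _) (++-assoc A (j ∷ B) U)
      (split (A ++ j ∷ B) (++-∷≢[] A) sorted'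
        (All.map (λ j<u → insert A (All.map (λ x<j → <-trans x<j j<u) AB<j) j<u) j<U))
    where
    ++-∷≢[] : ∀ A → A ++ j ∷ B ≢ []
    ++-∷≢[] [] ()
    ++-∷≢[] (_ ∷ _) ()
    insert : ∀ {P : Fin m → Set} A {B x} → All P (A ++ B) → P x → All P (A ++ x ∷ B)
    insert []      pB       px = px ∷ pB
    insert (_ ∷ A) (pa ∷ p) px = pa ∷ insert A p px
    sorted' : AllPairs _≺_ (A ++ j ∷ B)
    sorted' = AllPairs-insert⁺ A sorted (All.zipWith (λ { (a≤j , a<j) → ≤∧<⇒≺ a≤j a<j }) (A≤j , All.++⁻ˡ A AB<j))
                (All.map inj₁ B-above)
    split : ∀ L → (L ≢ []) → AllPairs _≺_ L → All (λ u → All (F._< u) L) U → Step (L ++ U) (NewKeyFrom U)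
    split L L≢[] sorted L<U with initLast L
    ... | []       = ⊥-elim (L≢[] refl)
    ... | Q ∷ʳ′ x  = step-in-rest Q x U sorted L<U U-inc

  Successor : ∀ {ys} → SortState ys → Fin m → ∀ {ys'} → SortState ys' → Set
  Successor D a D' =
    (key D' ≡ key D × a ∈ prefix D × prefix D' ⊆ prefix D × rest D' ≡ rest D) ⊎ NewKeyFrom (rest D) a D'

  step : ∀ {ys} (D : SortState ys) → Step ys (Successor D)
  step (sortState A B U j refl sorted B-above AB<j U-inc) with initLast A
  ... | [] = Sum.map₂ (λ { (a , ys' , D' , e , b , s) → a , ys' , D' , e , b , inj₂ s })
                      (step-after-key [] j B U sorted B-above AB<j U-inc [])
  ... | Q ∷ʳ′ a with val j <? val a
  ... | yes j<a = inj₂ (a , _ , D' ,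
          trans (cong leftSwap (++-assoc Q (a ∷ []) (j ∷ B ++ U)))
                (leftSwap-descent Q a j (B ++ U) (AllPairs-++⁻ˡ (Q ∷ʳ a) sorted) j<a) ,
          (B , refl) , inj₁ (refl , ∈-++⁺ʳ Q (here refl) , ∈-++⁺ˡ , refl))
    where
    D' : SortState (Q ++ j ∷ a ∷ B ++ U)
    D' = sortState Q (a ∷ B) U j refl (subst (AllPairs _≺_) (++-assoc Q (a ∷ []) B) sorted) (j<a ∷ B-above)
           (subst (All (F._< j)) (++-assoc Q (a ∷ []) B) AB<j) U-inc
  ... | no j≮a = Sum.map₂ (λ { (a' , ys' , D' , e , b , s) → a' , ys' , D' , e , b , inj₂ s })
                  (step-after-key (Q ∷ʳ a) j B U sorted B-above AB<j U-inc
                    (All.map (λ y≤a → ≤-trans y≤a (≮⇒≥ j≮a))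
                             (sorted-last-greatest Q a (AllPairs-++⁻ˡ (Q ∷ʳ a) sorted))))

  bubble-swap : ∀ f ys {p ys'} → leftSwap ys ≡ just (p , ys') → bubble (suc f) ys ≡ p ∷ bubble f ys'
  bubble-swap f ys e rewrite e = refl

  bubble-stop : ∀ f ys → leftSwap ys ≡ nothing → bubble (suc f) ys ≡ []
  bubble-stop f ys e rewrite e = refl

  bubble-column : ∀ f {ys} (D : SortState ys) {x y} → (x , y) ∈ bubble f ys →
    (y ≡ key D × x ∈ prefix D) ⊎ y ∈ rest D
  bubble-column (suc f) {ys} D {x} {y} xy∈ with step D
  ... | inj₁ stop with subst ((x , y) ∈_) (bubble-stop f ys stop) xy∈
  ... | ()
  bubble-column (suc f) {ys} D {x} {y} xy∈ | inj₂ (a , ys' , D' , e , _ , succ)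
    with subst ((x , y) ∈_) (bubble-swap f ys e) xy∈ | succ
  ... | here refl | inj₁ (key≡ , a∈ , _ , _) = inj₁ (key≡ , a∈)
  ... | here refl | inj₂ new = inj₂ (new (here refl))
  ... | there xy∈' | succ' with bubble-column f D' xy∈' | succ'
  ... | inj₁ (y≡ , x∈) | inj₁ (key≡ , _ , prefix⊆ , _) = inj₁ (trans y≡ key≡ , prefix⊆ x∈)
  ... | inj₁ (y≡ , _)  | inj₂ new                      = inj₂ (new (here y≡))
  ... | inj₂ y∈        | inj₁ (_ , _ , _ , rest≡)      = inj₂ (subst (y ∈_) rest≡ y∈)
  ... | inj₂ y∈        | inj₂ new                      = inj₂ (new (there y∈))

  bubble-inversion : ∀ f {ys} (D : SortState ys) {x y} → (x , y) ∈ bubble f ys → x F.< y × val y < val x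
  bubble-inversion (suc f) {ys} D {x} {y} xy∈ with step D
  ... | inj₁ stop with subst ((x , y) ∈_) (bubble-stop f ys stop) xy∈
  ... | ()
  bubble-inversion (suc f) {ys} D {x} {y} xy∈ | inj₂ (a , ys' , D' , e , (B' , passed≡) , _)
    with subst ((x , y) ∈_) (bubble-swap f ys e) xy∈
  ... | there xy∈' = bubble-inversion f D' xy∈'
  ... | here refl  = All.lookup (key-greatest D') (∈-++⁺ʳ (prefix D') a∈passed) ,
                     All.lookup (passed-above D') a∈passed
    where
    a∈passed : a ∈ passed D'
    a∈passed = subst (a ∈_) (sym passed≡) (here refl)

  bubble-row-order : ∀ f {ys} (D : SortState ys) {i j j'} → (i , j) ∈ bubble f ys → (i , j') ∈ bubble f ys →
    j F.< j' → Before (bubble f ys) (i , j) (i , j')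
  bubble-row-order (suc f) {ys} D {i} {j} {j'} ij∈ ij'∈ j<j' with step D
  ... | inj₁ stop with subst ((i , j) ∈_) (bubble-stop f ys stop) ij∈
  ... | ()
  bubble-row-order (suc f) {ys} D {i} {j} {j'} ij∈ ij'∈ j<j' | inj₂ (a , ys' , D' , e , _ , _) =
    subst (λ l → Before l _ _) (sym unfold) (order (subst (_ ∈_) unfold ij∈) (subst (_ ∈_) unfold ij'∈))
    where
    unfold : bubble (suc f) ys ≡ (a , key D') ∷ bubble f ys'
    unfold = bubble-swap f ys e
    order : (i , j) ∈ (a , key D') ∷ bubble f ys' → (i , j') ∈ (a , key D') ∷ bubble f ys' →
            Before ((a , key D') ∷ bubble f ys') (i , j) (i , j')
    order (here refl) (here refl) = ⊥-elim (<-irrefl refl j<j')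
    order (here refl) (there q)   = Before-here q
    order (there q)   (here refl) with bubble-column f D' q
    ... | inj₁ (refl , _) = ⊥-elim (<-irrefl refl j<j')
    ... | inj₂ j∈rest     = ⊥-elim (<-asym j<j' (key<rest D' j∈rest))
    order (there q) (there q') = Before-∷ _ (bubble-row-order f D' q q' j<j')

  bubble-column-order : ∀ f {ys} (D : SortState ys) {i i' j} → (i , j) ∈ bubble f ys → (i' , j) ∈ bubble f ys →
    val i ≡ val i' → i' F.< i → Before (bubble f ys) (i , j) (i' , j)
  bubble-column-order (suc f) {ys} D {i} {i'} {j} ij∈ i'j∈ i≈i' i'<i with step D
  ... | inj₁ stop with subst ((i , j) ∈_) (bubble-stop f ys stop) ij∈
  ... | ()
  bubble-column-order (suc f) {ys} D {i} {i'} {j} ij∈ i'j∈ i≈i' i'<i | inj₂ (a , ys' , D' , e , (B' , passed≡) , _) =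
    subst (λ l → Before l _ _) (sym unfold) (order (subst (_ ∈_) unfold ij∈) (subst (_ ∈_) unfold i'j∈))
    where
    unfold : bubble (suc f) ys ≡ (a , key D') ∷ bubble f ys'
    unfold = bubble-swap f ys e
    order : (i , j) ∈ (a , key D') ∷ bubble f ys' → (i' , j) ∈ (a , key D') ∷ bubble f ys' →
            Before ((a , key D') ∷ bubble f ys') (i , j) (i' , j)
    order (here refl) (here refl) = ⊥-elim (<-irrefl refl i'<i)
    order (here refl) (there q)   = Before-here q
    order (there q)   (here refl) with bubble-column f D' q
    ... | inj₂ j∈rest = ⊥-elim (<-irrefl refl (key<rest D' j∈rest))
    ... | inj₁ (_ , i∈prefix)
      with AllPairs-middle (prefix D') (subst (λ z → AllPairs _≺_ (prefix D' ++ z)) passed≡ (sorted D')) i∈prefix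
    ... | inj₁ i<i'      = ⊥-elim (<-irrefl i≈i' i<i')
    ... | inj₂ (_ , i<i') = ⊥-elim (<-asym i'<i i<i')
    order (there q) (there q') = Before-∷ _ (bubble-column-order f D' q q' i≈i' i'<i)


module TileFacts {n : ℕ} (w : Vec Letter (suc n)) where
  open Tiling w using (val)
  open TilingOrder w

  initial : SortState (allFin (suc n))
  initial = sortState [] [] (tabulate F.suc) F.zero refl [] [] [] (AllPairs.tabulate⁺-< (λ i<j → i<j))

  tile-inversion : ∀ {i j} → (i , j) ∈ tiles w → i F.< j × val j < val i
  tile-inversion = bubble-inversion _ initial

  row-tiles-ordered : ∀ {i j j'} → (i , j) ∈ tiles w → (i , j') ∈ tiles w → j F.< j' →
    Before (tiles w) (i , j) (i , j')
  row-tiles-ordered = bubble-row-order _ initial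

  column-tiles-ordered : ∀ {i i' j} → (i , j) ∈ tiles w → (i' , j) ∈ tiles w → val i ≡ val i' → i' F.< i →
    Before (tiles w) (i , j) (i' , j)
  column-tiles-ordered = bubble-column-order _ initial

-- Inserting a block into a word

module _ {A : Set} where

  Adjacent : List A → A → A → Set
  Adjacent v a y = ∃[ xs ] ∃[ zs ] (v ≡ xs ++ a ∷ y ∷ zs)

  IsLast : List A → A → Set
  IsLast v a = ∃[ xs ] (v ≡ xs ++ a ∷ [])

  Precedes : List A → A → A → Set
  Precedes v a y = ∃[ xs ] ∃[ ys ] (v ≡ xs ++ a ∷ ys × y ∈ ys)

  ++-∷-align : ∀ xs (a : A) ys P t Q → xs ++ a ∷ ys ≡ P ++ t ∷ Q →
    (∃[ Q' ] (t ∷ Q ≡ Q' ++ a ∷ ys)) ⊎ (∃[ P' ] (P ≡ xs ++ a ∷ P' × ys ≡ P' ++ t ∷ Q))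
  ++-∷-align xs a ys [] t Q e = inj₁ (xs , sym e)
  ++-∷-align [] a ys (p ∷ P) t Q e with ∷-injective e
  ... | refl , e' = inj₂ (P , refl , e')
  ++-∷-align (x ∷ xs) a ys (p ∷ P) t Q e with ∷-injective e
  ... | refl , e' with ++-∷-align xs a ys P t Q e'
  ... | inj₁ (Q' , tQ≡)       = inj₁ (Q' , tQ≡)
  ... | inj₂ (P' , P≡ , ys≡) = inj₂ (P' , cong (x ∷_) P≡ , ys≡)

  Unique-middle : ∀ P {t : A} {Q} → Unique (P ++ t ∷ Q) → t ∉ P × t ∉ Q
  Unique-middle []      (t∉ ∷ _) = (λ ()) , λ t∈Q → All.lookup t∉ t∈Q refl
  Unique-middle (x ∷ P) (x∉ ∷ u) with Unique-middle P u
  ... | t∉P , t∉Q = (λ { (here refl) → All.lookup x∉ (∈-++⁺ʳ P (here refl)) refl ; (there t∈P) → t∉P t∈P }) , t∉Q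

  Unique-position : ∀ xs {a : A} {ys} xs' ys' → Unique (xs ++ a ∷ ys) → xs ++ a ∷ ys ≡ xs' ++ a ∷ ys' →
    xs ≡ xs' × ys ≡ ys'
  Unique-position [] [] ys' _ e = refl , proj₂ (∷-injective e)
  Unique-position [] (x ∷ xs') ys' (a∉ ∷ _) e with ∷-injective e
  ... | refl , e' = ⊥-elim (All.lookup a∉ (subst (_ ∈_) (sym e') (∈-++⁺ʳ xs' (here refl))) refl)
  Unique-position (x ∷ xs) [] ys' (x∉ ∷ _) e with ∷-injective e
  ... | refl , _ = ⊥-elim (All.lookup x∉ (∈-++⁺ʳ xs (here refl)) refl)
  Unique-position (x ∷ xs) (x' ∷ xs') ys' (_ ∷ u) e with ∷-injective e
  ... | refl , e' with Unique-position xs xs' ys' u e'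
  ... | refl , ys≡ = refl , ys≡

  ++-assoc₃ : ∀ (P B C X : List A) → P ++ B ++ C ++ X ≡ (P ++ B ++ C) ++ X
  ++-assoc₃ P B C X = trans (cong (P ++_) (sym (++-assoc B C X))) (sym (++-assoc P (B ++ C) X))

  module BlockInsertion (P blk : List A) (t : A) (Q : List A) where

    v v' : List A
    v  = P ++ t ∷ Q
    v' = P ++ blk ++ t ∷ Q

    adjacent-preserved : ∀ {a y b blk'} → blk ≡ b ∷ blk' → Unique v → Adjacent v a y →
      (y ≡ t × Adjacent v' a b) ⊎ (y ≢ t × Adjacent v' a y)
    adjacent-preserved {a} {y} {b} {blk'} blk≡ u (xs , zs , e) with ++-∷-align xs a (y ∷ zs) P t Q (sym e)
    ... | inj₁ (Q' , tQ≡) = inj₂ (y≢t , P ++ blk ++ Q' , zs , trans (cong (λ z → P ++ blk ++ z) tQ≡) (++-assoc₃ P blk Q' _))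
      where
      y∈ : ∀ Q' → t ∷ Q ≡ Q' ++ a ∷ y ∷ zs → y ∈ Q
      y∈ []       tQ≡' = subst (_ ∈_) (sym (proj₂ (∷-injective tQ≡'))) (here refl)
      y∈ (_ ∷ Q″) tQ≡' = subst (_ ∈_) (sym (proj₂ (∷-injective tQ≡'))) (∈-++⁺ʳ Q″ (there (here refl)))
      y≢t : y ≢ t
      y≢t refl = proj₂ (Unique-middle P u) (y∈ Q' tQ≡)
    ... | inj₂ ([] , P≡ , yzs≡) with ∷-injective yzs≡
    ... | refl , zs≡ = inj₁ (refl , xs , blk' ++ y ∷ zs , eq)
      where
      eq : v' ≡ xs ++ a ∷ b ∷ blk' ++ y ∷ zs
      eq rewrite P≡ | zs≡ | blk≡ = ++-assoc xs (a ∷ []) _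
    adjacent-preserved {a} {y} {b} {blk'} blk≡ u (xs , zs , e) | inj₂ (y' ∷ P' , P≡ , yzs≡) with ∷-injective yzs≡
    ... | refl , zs≡ = inj₂ (y≢t , xs , P' ++ blk ++ t ∷ Q , eq)
      where
      y≢t : y ≢ t
      y≢t refl = proj₁ (Unique-middle P u) (subst (_ ∈_) (sym P≡) (∈-++⁺ʳ xs (there (here refl))))
      eq : v' ≡ xs ++ a ∷ y ∷ P' ++ blk ++ t ∷ Q
      eq rewrite P≡ = ++-assoc xs (a ∷ y ∷ P') _

    isLast-preserved : ∀ {a} → IsLast v a → IsLast v' a
    isLast-preserved {a} (xs , e) with ++-∷-align xs a [] P t Q (sym e)
    ... | inj₁ (Q' , tQ≡) = P ++ blk ++ Q' , trans (cong (λ z → P ++ blk ++ z) tQ≡) (++-assoc₃ P blk Q' _)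
    ... | inj₂ ([] , _ , ())
    ... | inj₂ (_ ∷ _ , _ , ())

    split-preserved : ∀ {a xs ys} → v ≡ xs ++ a ∷ ys →
      (∃[ xs' ] (v' ≡ xs' ++ a ∷ ys)) ⊎ (∃[ P' ] (ys ≡ P' ++ t ∷ Q × v' ≡ xs ++ a ∷ P' ++ blk ++ t ∷ Q))
    split-preserved {a} {xs} {ys} e with ++-∷-align xs a ys P t Q (sym e)
    ... | inj₁ (Q' , tQ≡) = inj₁ (P ++ blk ++ Q' , trans (cong (λ z → P ++ blk ++ z) tQ≡) (++-assoc₃ P blk Q' _))
    ... | inj₂ (P' , P≡ , ys≡) = inj₂ (P' , ys≡ , eq)
      where
      eq : v' ≡ xs ++ a ∷ P' ++ blk ++ t ∷ Q
      eq rewrite P≡ = ++-assoc xs (a ∷ P') _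

    precedes-preserved : ∀ {a y} → Precedes v a y → Precedes v' a y
    precedes-preserved {a} {y} (xs , ys , e , y∈ys) with split-preserved e
    ... | inj₁ (xs' , e') = xs' , ys , e' , y∈ys
    ... | inj₂ (P' , ys≡ , e') = xs , _ , e' , y∈
      where
      y∈ : y ∈ P' ++ blk ++ t ∷ Q
      y∈ with ∈-++⁻ P' (subst (y ∈_) ys≡ y∈ys)
      ... | inj₁ y∈P' = ∈-++⁺ˡ y∈P'
      ... | inj₂ y∈tQ = ∈-++⁺ʳ P' (∈-++⁺ʳ blk y∈tQ)

    ∈-inserted⁻ : ∀ {a} → a ∈ v' → a ∈ v ⊎ a ∈ blk
    ∈-inserted⁻ a∈ with ∈-++⁻ P a∈
    ... | inj₁ a∈P = inj₁ (∈-++⁺ˡ a∈P)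
    ... | inj₂ a∈ with ∈-++⁻ blk a∈
    ... | inj₁ a∈blk = inj₂ a∈blk
    ... | inj₂ a∈tQ  = inj₁ (∈-++⁺ʳ P a∈tQ)

    ∈-original⁺ : ∀ {a} → a ∈ v → a ∈ v'
    ∈-original⁺ a∈ with ∈-++⁻ P a∈
    ... | inj₁ a∈P  = ∈-++⁺ˡ a∈P
    ... | inj₂ a∈tQ = ∈-++⁺ʳ P (∈-++⁺ʳ blk a∈tQ)

    ∈-block⁺ : ∀ {a} → a ∈ blk → a ∈ v'
    ∈-block⁺ a∈ = ∈-++⁺ʳ P (∈-++⁺ˡ a∈)

    unique-inserted : Unique v → Unique blk → (∀ {b} → b ∈ blk → b ∉ v) → Unique v'
    unique-inserted = go P
      where
      prepend : ∀ B {R} → Unique B → Unique R → (∀ {b} → b ∈ B → b ∉ R) → Unique (B ++ R)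
      prepend []      _        uR _    = uR
      prepend (b ∷ B) (b∉ ∷ uB) uR disj =
        All.++⁺ b∉ (All.tabulate (λ z∈R b≡z → disj (here refl) (subst (_∈ _) (sym b≡z) z∈R)))
        ∷ prepend B uB uR (λ b∈ → disj (there b∈))
      go : ∀ P₀ → Unique (P₀ ++ t ∷ Q) → Unique blk → (∀ {b} → b ∈ blk → b ∉ P₀ ++ t ∷ Q) →
           Unique (P₀ ++ blk ++ t ∷ Q)
      go []       u        ub disj = prepend blk ub u disj
      go (x ∷ P₀) (x∉ ∷ u) ub disj = All.tabulate x≢ ∷ go P₀ u ub (λ b∈ b∈' → disj b∈ (there b∈'))
        where
        x≢ : ∀ {z} → z ∈ P₀ ++ blk ++ t ∷ Q → x ≢ z
        x≢ z∈ x≡z with ∈-++⁻ P₀ z∈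
        ... | inj₁ z∈P₀ = All.lookup x∉ (∈-++⁺ˡ z∈P₀) x≡z
        ... | inj₂ z∈ with ∈-++⁻ blk z∈
        ... | inj₁ z∈blk = disj z∈blk (here (sym x≡z))
        ... | inj₂ z∈tQ  = All.lookup x∉ (∈-++⁺ʳ P₀ z∈tQ) x≡z

  AllPairs-split : ∀ {R : A → A → Set} B {x} → AllPairs R B → x ∈ B →
    ∃[ xs ] ∃[ ys ] (B ≡ xs ++ x ∷ ys × All (R x) ys)
  AllPairs-split (b ∷ B) (Rb ∷ _)  (here refl) = [] , B , refl , Rb
  AllPairs-split (b ∷ B) (_ ∷ pB) (there x∈) with AllPairs-split B pB x∈
  ... | xs , ys , B≡ , Rx = b ∷ xs , ys , cong (b ∷_) B≡ , Rx

  AllPairs-last : ∀ {R : A → A → Set} L {z x} → AllPairs R (L ∷ʳ z) → x ∈ L → R x z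
  AllPairs-last (_ ∷ L) (Ry ∷ _)  (here refl) = All.lookup Ry (∈-++⁺ʳ L (here refl))
  AllPairs-last (_ ∷ L) (_ ∷ pL) (there x∈)  = AllPairs-last L pL x∈

  adjacent-in-sorted : ∀ {R : A → A → Set} → (∀ {a} → ¬ R a a) → ∀ P L z T {x} → AllPairs R (L ∷ʳ z) → x ∈ L →
    ∃[ y ] (Adjacent (P ++ (L ∷ʳ z) ++ T) x y × R x y)
  adjacent-in-sorted irrefl P L z T {x} sorted x∈ with AllPairs-split (L ∷ʳ z) sorted (∈-++⁺ˡ x∈)
  ... | xs , [] , e , _ with ∷ʳ-injective L xs e
  ... | _ , refl = ⊥-elim (irrefl (AllPairs-last L sorted x∈))
  adjacent-in-sorted irrefl P L z T {x} sorted x∈ | xs , y ∷ ys , e , (Rxy ∷ _) = y , (P ++ xs , ys ++ T , eq) , Rxy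
    where
    eq : P ++ (L ∷ʳ z) ++ T ≡ (P ++ xs) ++ x ∷ y ∷ ys ++ T
    eq rewrite e = trans (cong (P ++_) (++-assoc xs (x ∷ y ∷ ys) T)) (sym (++-assoc P xs _))

  adjacent-last : ∀ P L (z t : A) Q → Adjacent (P ++ (L ∷ʳ z) ++ t ∷ Q) z t
  adjacent-last P L z t Q = P ++ L , Q , trans (cong (P ++_) (++-assoc L (z ∷ []) (t ∷ Q))) (sym (++-assoc P L _))

  precedes-from-block : ∀ P blk (t : A) Q {x} → x ∈ blk → Precedes (P ++ blk ++ t ∷ Q) x t
  precedes-from-block P blk t Q {x} x∈ with ∈-∃++ x∈
  ... | xs , ys , e = P ++ xs , ys ++ t ∷ Q , eq , ∈-++⁺ʳ ys (here refl)
    where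
    eq : P ++ blk ++ t ∷ Q ≡ (P ++ xs) ++ x ∷ ys ++ t ∷ Q
    eq rewrite e = trans (cong (P ++_) (++-assoc xs (x ∷ ys) (t ∷ Q))) (sym (++-assoc P xs _))

module _ {A : Set} where

  module _ (p q : A → Bool) (p⇒q : ∀ {x} → T (p x) → T (q x)) where

    length-filterᵇ-mono : ∀ xs → length (filterᵇ p xs) ≤ length (filterᵇ q xs)
    length-filterᵇ-mono []       = z≤n
    length-filterᵇ-mono (x ∷ xs) with p x in px | q x in qx
    ... | true  | true  = s≤s (length-filterᵇ-mono xs)
    ... | true  | false = ⊥-elim (subst T qx (p⇒q (subst T (sym px) tt)))
    ... | false | true  = m≤n⇒m≤1+n (length-filterᵇ-mono xs)
    ... | false | false = length-filterᵇ-mono xs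

    length-filterᵇ-strict : ∀ xs {y} → y ∈ xs → ¬ T (p y) → T (q y) → length (filterᵇ p xs) < length (filterᵇ q xs)
    length-filterᵇ-strict (x ∷ xs) (here refl) ¬py qy with p x in px | q x in qx
    ... | true  | _     = ⊥-elim (¬py tt)
    ... | false | false = ⊥-elim qy
    ... | false | true  = s≤s (length-filterᵇ-mono xs)
    length-filterᵇ-strict (x ∷ xs) (there y∈) ¬py qy with p x in px | q x in qx
    ... | true  | true  = s≤s (length-filterᵇ-strict xs y∈ ¬py qy)
    ... | true  | false = ⊥-elim (subst T qx (p⇒q (subst T (sym px) tt)))
    ... | false | true  = m≤n⇒m≤1+n (length-filterᵇ-strict xs y∈ ¬py qy)
    ... | false | false = length-filterᵇ-strict xs y∈ ¬py qy

  length-filterᵇ-pos : ∀ (p : A → Bool) xs {y} → y ∈ xs → T (p y) → 1 ≤ length (filterᵇ p xs)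
  length-filterᵇ-pos p (x ∷ xs) y∈ py with p x in px
  ... | true = s≤s z≤n
  length-filterᵇ-pos p (x ∷ xs) (here refl) py | false = ⊥-elim (subst T px py)
  length-filterᵇ-pos p (x ∷ xs) (there y∈)  py | false = length-filterᵇ-pos p xs y∈ py

  head-filterᵇ : ∀ (p : A → Bool) xs {y} → y ∈ xs → T (p y) → ∃[ h ] (head (filterᵇ p xs) ≡ just h × T (p h))
  head-filterᵇ p (x ∷ xs) y∈ py with p x in px
  ... | true = x , refl , subst T (sym px) tt
  head-filterᵇ p (x ∷ xs) (here refl) py | false = ⊥-elim (subst T px py)
  head-filterᵇ p (x ∷ xs) (there y∈)  py | false = head-filterᵇ p xs y∈ py

  ∈-filterᵇ⁻ : ∀ (p : A → Bool) {xs x} → x ∈ filterᵇ p xs → T (p x)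
  ∈-filterᵇ⁻ p {xs} x∈ = proj₂ (∈-filter⁻ (λ z → T? (p z)) {xs = xs} x∈)

  ∈-filterᵇ⁺ : ∀ (p : A → Bool) {xs x} → x ∈ xs → T (p x) → x ∈ filterᵇ p xs
  ∈-filterᵇ⁺ p = ∈-filter⁺ (λ z → T? (p z))

  AllPairs-filterᵇ : ∀ {R : A → A → Set} (p : A → Bool) {xs} → AllPairs R xs → AllPairs R (filterᵇ p xs)
  AllPairs-filterᵇ p = AllPairs.filter⁺ (λ z → T? (p z))

length-filterᵇ-tabulate : ∀ {k} {B C : Set} (f : Fin k → B) (g : Fin k → C) (p : B → Bool) (q : C → Bool) →
  (∀ i → p (f i) ≡ q (g i)) → length (filterᵇ p (tabulate f)) ≡ length (filterᵇ q (tabulate g))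
length-filterᵇ-tabulate {zero}  f g p q pf≡qg = refl
length-filterᵇ-tabulate {suc k} f g p q pf≡qg with p (f F.zero) | q (g F.zero) | pf≡qg F.zero
... | true  | .true  | refl = cong suc (length-filterᵇ-tabulate (f ∘ F.suc) (g ∘ F.suc) p q (pf≡qg ∘ F.suc))
... | false | .false | refl = length-filterᵇ-tabulate (f ∘ F.suc) (g ∘ F.suc) p q (pf≡qg ∘ F.suc)

isYes-∧⁻ : ∀ {P : Set} (p? : Dec P) {b} → T (isYes p? ∧ b) → P × T b
isYes-∧⁻ (yes p) t = p , t

isYes-∧⁺ : ∀ {P : Set} (p? : Dec P) {b} → P → T b → T (isYes p? ∧ b)
isYes-∧⁺ (yes _)  _ t = t
isYes-∧⁺ (no ¬p) p _ = ¬p p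

isDiag : ∀ {m} → Vec Letter m → Fin m → Bool
isDiag w k = isYes (lookup w k ≟L L1)

length-filterᵇ-isDiag-∷ : ∀ {m} x (w : Vec Letter m) →
  length (filterᵇ (isDiag w) (allFin m)) ≡ length (filterᵇ (isDiag (x V.∷ w)) (tabulate F.suc))
length-filterᵇ-isDiag-∷ x w = length-filterᵇ-tabulate (λ i → i) F.suc (isDiag w) (isDiag (x V.∷ w)) (λ _ → refl)

countDiag≡length-filterᵇ : ∀ {m} (w : Vec Letter m) → countDiag w ≡ length (filterᵇ (isDiag w) (allFin m))
countDiag≡length-filterᵇ V.[] = refl
countDiag≡length-filterᵇ (L0 V.∷ w) = trans (countDiag≡length-filterᵇ w) (length-filterᵇ-isDiag-∷ L0 w)
countDiag≡length-filterᵇ (L1 V.∷ w) = cong suc (trans (countDiag≡length-filterᵇ w) (length-filterᵇ-isDiag-∷ L1 w))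
countDiag≡length-filterᵇ (L2 V.∷ w) = trans (countDiag≡length-filterᵇ w) (length-filterᵇ-isDiag-∷ L2 w)

-- Local structure of a RAT

module RATFacts {n r : ℕ} (R : RATplus n r) where
  open RATplus R
  open Insertion R
  open TileFacts w
  open Tiling w using (val)

  Strip : Set
  Strip = Fin (suc n)

  symOf : Strip → Sym
  symOf i = num (label i)

  left-cell : ∀ {i j} → fill i j ≡ left → lookup w i ≡ L2 × i F.< j × lookup w j ≢ L2
  left-cell {i} {j} ij-left with leftValid i j ij-left
  ... | ij∈ , wi with tile-inversion ij∈
  ... | i<j , vj<vi = wi , i<j , λ wj → <-irrefl refl (subst₂ (λ a b → rank a < rank b) wj wi vj<vi)

  up-cell : ∀ {i j} → fill i j ≡ up → lookup w j ≡ L0 × i F.< j × lookup w i ≢ L0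
  up-cell {i} {j} ij-up with upValid i j ij-up
  ... | ij∈ , wj with tile-inversion ij∈
  ... | i<j , vj<vi = wj , i<j , λ wi → <-irrefl refl (subst₂ (λ a b → rank a < rank b) wj wi vj<vi)

  left-points-empty : ∀ {i j j'} → fill i j ≡ left → (i , j') ∈ tiles w → j F.< j' → fill i j' ≡ none
  left-points-empty {i} {j} {j'} ij ij'∈ j<j' =
    leftPoint i j j' ij (row-tiles-ordered (proj₁ (leftValid i j ij)) ij'∈ j<j')

  up-points-empty : ∀ {i i' j} → fill i j ≡ up → (i' , j) ∈ tiles w → val i ≡ val i' → i' F.< i → fill i' j ≡ none
  up-points-empty {i} {i'} {j} ij i'j∈ vi≡vi' i'<i =
    upPoint i i' j ij (column-tiles-ordered (proj₁ (upValid i j ij)) i'j∈ vi≡vi' i'<i)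

  left-unique : ∀ {i j j'} → fill i j ≡ left → fill i j' ≡ left → j ≡ j'
  left-unique {i} {j} {j'} ij ij' with <-cmp (toℕ j) (toℕ j')
  ... | tri< j<j' _ _ = contradiction (trans (sym ij') (left-points-empty ij (proj₁ (leftValid i j' ij')) j<j')) λ ()
  ... | tri≈ _ j≡j' _ = F.toℕ-injective j≡j'
  ... | tri> _ _ j'<j = contradiction (trans (sym ij) (left-points-empty ij' (proj₁ (leftValid i j ij)) j'<j)) λ ()

  up-east-of-left : ∀ {h ℓ c} → fill h ℓ ≡ up → fill h c ≡ left → ℓ F.< c
  up-east-of-left {h} {ℓ} {c} hℓ hc with <-cmp (toℕ ℓ) (toℕ c)
  ... | tri< ℓ<c _ _ = ℓ<c
  ... | tri> _ _ c<ℓ = contradiction (trans (sym hℓ) (left-points-empty hc (proj₁ (upValid h ℓ hℓ)) c<ℓ)) λ ()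
  ... | tri≈ _ ℓ≡c _ with F.toℕ-injective ℓ≡c
  ...   | refl = contradiction (trans (sym hℓ) hc) λ ()

  up-north-of-left : ∀ {h ℓ i} → fill h ℓ ≡ up → lookup w h ≡ L2 → fill i ℓ ≡ left → h F.< i
  up-north-of-left {h} {ℓ} {i} hℓ wh iℓ with <-cmp (toℕ h) (toℕ i)
  ... | tri< h<i _ _ = h<i
  ... | tri> _ _ i<h = contradiction (trans (sym iℓ)
        (up-points-empty hℓ (proj₁ (leftValid i ℓ iℓ)) (cong rank (trans wh (sym (proj₁ (left-cell iℓ))))) i<h)) λ ()
  ... | tri≈ _ h≡i _ with F.toℕ-injective h≡i
  ...   | refl = contradiction (trans (sym hℓ) iℓ) λ ()

  diagUpTo : Strip → Strip → Bool
  diagUpTo h k = isYes (toℕ k ≤? toℕ h) ∧ isYes (lookup w k ≟L L1)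

  diagIndex-pos : ∀ h → 1 ≤ diagIndex h
  diagIndex-pos h = length-filterᵇ-pos (diagUpTo h) (allFin (suc n)) (∈-allFin F.zero)
    (isYes-∧⁺ (0 ≤? toℕ h) z≤n (fromWitness firstDiag))

  diagIndex≤ : ∀ h → diagIndex h ≤ suc r
  diagIndex≤ h = subst (diagIndex h ≤_) (trans (sym (countDiag≡length-filterᵇ w)) diagCount)
    (length-filterᵇ-mono (diagUpTo h) (isDiag w) (proj₂ ∘ isYes-∧⁻ (_ ≤? _)) (allFin (suc n)))

  diagIndex-strict : ∀ {h d} → h F.< d → lookup w d ≡ L1 → diagIndex h < diagIndex d
  diagIndex-strict {h} {d} h<d wd =
    length-filterᵇ-strict (diagUpTo h) (diagUpTo d) upTo-h⇒upTo-d (allFin (suc n)) (∈-allFin d)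
      (λ t → <⇒≱ h<d (proj₁ (isYes-∧⁻ (_ ≤? _) t)))
      (isYes-∧⁺ (toℕ d ≤? toℕ d) ≤-refl (fromWitness wd))
    where
    upTo-h⇒upTo-d : ∀ {k} → T (diagUpTo h k) → T (diagUpTo d k)
    upTo-h⇒upTo-d {k} t with isYes-∧⁻ (toℕ k ≤? toℕ h) t
    ... | k≤h , wk = isYes-∧⁺ (toℕ k ≤? toℕ d) (≤-trans k≤h (<⇒≤ h<d)) wk

  InitialEps : Sym → Set
  InitialEps a = ∃[ t ] (a ≡ eps (suc t) × t < suc r)

  InitialEps-diagIndex : ∀ h → InitialEps (eps (diagIndex h))
  InitialEps-diagIndex h with diagIndex h | diagIndex-pos h | diagIndex≤ h
  ... | suc t | _ | s≤s t≤r = t , refl , s≤s t≤r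

  firstUp-found : ∀ {ℓ} → lookup w ℓ ≡ L0 → ∃[ h ] (firstUp ℓ ≡ just h × fill h ℓ ≡ up)
  firstUp-found {ℓ} wℓ with colHasUp ℓ wℓ
  ... | i , iℓ with head-filterᵇ (λ h → isYes (fill h ℓ ≟A up)) (allFin (suc n)) (∈-allFin i) (fromWitness iℓ)
  ... | h , first≡ , hℓ = h , first≡ , toWitness hℓ

  ∈-leftLabels⁻ : ∀ {ℓ a} → a ∈ leftLabels ℓ → ∃[ i ] (a ≡ symOf i × fill i ℓ ≡ left)
  ∈-leftLabels⁻ {ℓ} a∈ with ∈-map⁻ symOf a∈
  ... | i , i∈ , refl = i , refl , toWitness (∈-filterᵇ⁻ (λ i → isYes (fill i ℓ ≟A left)) i∈)

  ∈-leftLabels⁺ : ∀ {ℓ i} → fill i ℓ ≡ left → symOf i ∈ leftLabels ℓ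
  ∈-leftLabels⁺ {ℓ} {i} iℓ =
    ∈-map⁺ symOf (∈-filterᵇ⁺ (λ i → isYes (fill i ℓ ≟A left)) (∈-allFin i) (fromWitness iℓ))

  block : Strip → List Sym
  block ℓ = leftLabels ℓ ++ symOf ℓ ∷ []

  ∈-block⁻ : ∀ {ℓ a} → a ∈ block ℓ → (∃[ i ] (a ≡ symOf i × fill i ℓ ≡ left)) ⊎ a ≡ symOf ℓ
  ∈-block⁻ {ℓ} a∈ with ∈-++⁻ (leftLabels ℓ) a∈
  ... | inj₁ a∈left    = inj₁ (∈-leftLabels⁻ a∈left)
  ... | inj₂ (here a≡) = inj₂ a≡

  block-increasing : ∀ ℓ → AllPairs _<ˢ_ (block ℓ)
  block-increasing ℓ =
    AllPairs.++⁺ (AllPairs.map⁺ (AllPairs-filterᵇ (λ i → isYes (fill i ℓ ≟A left)) (AllPairs.tabulate⁺-< (nn ∘ s≤s))))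
                 ([] ∷ []) (All.tabulate (λ a∈ → below-ℓ (∈-leftLabels⁻ a∈)))
    where
    below-ℓ : ∀ {a} → ∃[ i ] (a ≡ symOf i × fill i ℓ ≡ left) → All (a <ˢ_) (symOf ℓ ∷ [])
    below-ℓ (i , refl , iℓ) = nn (s≤s (proj₁ (proj₂ (left-cell iℓ)))) ∷ []

  freeB⇒FreeRow : ∀ {i} → T (freeB i) → FreeRow R i
  freeB⇒FreeRow {i} t with isYes-∧⁻ (lookup w i ≟L L2) t
  ... | wi , no-left = wi ,
        λ j → toWitnessFalse (All.lookup (All.all⁺ (λ j → not (isYes (fill i j ≟A left))) (allFin (suc n)) no-left)
                                         (∈-allFin j))

  FreeRow⇒freeB : ∀ {i} → FreeRow R i → T (freeB i)
  FreeRow⇒freeB {i} (wi , no-left) =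
    isYes-∧⁺ (lookup w i ≟L L2) wi (All.all⁻ _ {xs = allFin (suc n)} (All.tabulate λ {j} _ → not-left j))
    where
    not-left : ∀ j → T (not (isYes (fill i j ≟A left)))
    not-left j with fill i j ≟A left
    ... | yes ij = no-left j ij
    ... | no _   = tt

  ∈-initWord⁻ : ∀ {a} → a ∈ initWord → InitialEps a ⊎ ∃[ i ] (a ≡ symOf i × FreeRow R i)
  ∈-initWord⁻ a∈ with ∈-++⁻ (map (λ t → eps (suc t)) (upTo (suc r))) a∈
  ... | inj₁ a∈eps with ∈-map⁻ (λ t → eps (suc t)) a∈eps
  ...   | t , t∈ , refl = inj₁ (t , refl , ∈-upTo⁻ t∈)
  ∈-initWord⁻ a∈ | inj₂ a∈free with ∈-map⁻ symOf a∈free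
  ...   | i , i∈ , refl = inj₂ (i , refl , freeB⇒FreeRow (∈-filterᵇ⁻ freeB i∈))

  eps∈initWord : ∀ {t} → t < suc r → eps (suc t) ∈ initWord
  eps∈initWord t<r = ∈-++⁺ˡ (∈-map⁺ (λ t → eps (suc t)) (∈-upTo⁺ t<r))

  free∈initWord : ∀ {i} → FreeRow R i → symOf i ∈ initWord
  free∈initWord {i} free = ∈-++⁺ʳ (map (λ t → eps (suc t)) (upTo (suc r)))
    (∈-map⁺ symOf (∈-filterᵇ⁺ freeB (∈-allFin i) (FreeRow⇒freeB free)))

  initWord-increasing : AllPairs _<ˢ_ initWord
  initWord-increasing =
    AllPairs.++⁺ (AllPairs.map⁺ (AllPairs.applyUpTo⁺₁ _ (suc r) (λ t<t' _ → ee (s≤s t<t'))))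
                 (AllPairs.map⁺ (AllPairs-filterᵇ freeB (AllPairs.tabulate⁺-< (nn ∘ s≤s))))
                 (All.tabulate (λ a∈ → All.tabulate (λ b∈ → eps<num (∈-map⁻ _ a∈) (∈-map⁻ symOf b∈))))
    where
    eps<num : ∀ {a b} → ∃[ t ] (t ∈ upTo (suc r) × a ≡ eps (suc t)) →
              ∃[ i ] (i ∈ filterᵇ freeB (allFin (suc n)) × b ≡ symOf i) → a <ˢ b
    eps<num (_ , _ , refl) (_ , _ , refl) = en

-- The invariant of the insertion map

<ˢ-irrefl : ∀ {a} → ¬ a <ˢ a
<ˢ-irrefl (ee a<a) = <-irrefl refl a<a
<ˢ-irrefl (nn a<a) = <-irrefl refl a<a

<ˢ-trans : ∀ {a b c} → a <ˢ b → b <ˢ c → a <ˢ c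
<ˢ-trans (ee a<b) (ee b<c) = ee (<-trans a<b b<c)
<ˢ-trans (ee _)   en       = en
<ˢ-trans en       (nn _)   = en
<ˢ-trans (nn a<b) (nn b<c) = nn (<-trans a<b b<c)

<ˢ⇒≢ : ∀ {a b} → a <ˢ b → a ≢ b
<ˢ⇒≢ a<a refl = <ˢ-irrefl a<a

diagonal-not-row : ∀ {x} → x ≡ L1 → x ≢ L2
diagonal-not-row refl ()

column-not-row : ∀ {x} → x ≡ L0 → x ≢ L2
column-not-row refl ()

eps-injective : ∀ {a b} → eps a ≡ eps b → a ≡ b
eps-injective refl = refl

num-injective : ∀ {a b} → num a ≡ num b → a ≡ b
num-injective refl = refl

num<ˢ⁻ : ∀ {a y} → num a <ˢ y → ∃[ k ] (y ≡ num k × a < k)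
num<ˢ⁻ (nn a<k) = _ , refl , a<k

insertBefore-split : ∀ t blk v → t ∈ v →
  ∃[ P ] ∃[ Q ] (v ≡ P ++ t ∷ Q × insertBefore t blk v ≡ P ++ blk ++ t ∷ Q)
insertBefore-split t blk (x ∷ xs) t∈ with x ≟S t | t∈
... | yes refl | _          = [] , xs , refl , refl
... | no x≢t   | here refl  = ⊥-elim (x≢t refl)
... | no _     | there t∈xs with insertBefore-split t blk xs t∈xs
... | P , Q , xs≡ , ins≡ = x ∷ P , Q , cong (x ∷_) xs≡ , cong (x ∷_) ins≡

module InsertionInvariant {n r : ℕ} (R : RATplus n r) where
  open RATplus R
  open Insertion R
  open RATFacts R

  -- Placed p i: the label of strip i is in the word once all strips of (0-based) index ≥ p are processed.
  Placed : ℕ → Strip → Set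
  Placed p i = FreeRow R i ⊎ (lookup w i ≢ L2 × p ≤ toℕ i) ⊎ (∃[ ℓ ] (fill i ℓ ≡ left × p ≤ toℕ ℓ))

  Present : ℕ → Sym → Set
  Present p a = InitialEps a ⊎ ∃[ i ] (a ≡ symOf i × Placed p i)

  -- An ε following a column belongs to a diagonal that is not processed yet, so it will be
  -- shifted right by a block of labels smaller than the column.
  ColumnSuccessor : ℕ → Strip → Sym → Set
  ColumnSuccessor p c y = (∃[ k ] (y ≡ num k × k < label c))
                        ⊎ (∃[ h ] (y ≡ eps (diagIndex h) × lookup w h ≡ L1 × toℕ h < p))

  RowAscent : List Sym → Strip → Set
  RowAscent v i = IsLast v (symOf i) ⊎ ∃[ k ] (Adjacent v (symOf i) (num k) × label i < k)

  record Invariant (p : ℕ) (v : List Sym) : Set where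
    field
      present⁻       : ∀ {a} → a ∈ v → Present p a
      present⁺       : ∀ {a} → Present p a → a ∈ v
      unique         : Unique v
      diagonal-eps   : ∀ i → lookup w i ≡ L1 → p ≤ toℕ i → Adjacent v (symOf i) (eps (diagIndex i))
      column-smaller : ∀ i → lookup w i ≡ L0 → p ≤ toℕ i → ∃[ y ] (Adjacent v (symOf i) y × ColumnSuccessor p i y)
      row-ascent     : ∀ i → lookup w i ≡ L2 → Placed p i → RowAscent v i
      free-rlmin     : ∀ i → FreeRow R i → RLMin v (symOf i)
      blocked-row    : ∀ i ℓ → fill i ℓ ≡ left → p ≤ toℕ ℓ → ∃[ y ] (Precedes v (symOf i) y × ¬ (symOf i <ˢ y))

  symOf-injective : ∀ {i j} → symOf i ≡ symOf j → i ≡ j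
  symOf-injective e = F.toℕ-injective (suc-injective (num-injective e))

  out-of-range : ∀ (i : Strip) → ¬ suc n ≤ toℕ i
  out-of-range i = <⇒≱ (F.toℕ<n i)

  initial-invariant : Invariant (suc n) initWord
  initial-invariant = record
    { present⁻       = Sum.map₂ (λ { (i , a≡ , free) → i , a≡ , inj₁ free }) ∘ ∈-initWord⁻
    ; present⁺       = present⁺
    ; unique         = AllPairs.map <ˢ⇒≢ initWord-increasing
    ; diagonal-eps   = λ i _ → ⊥-elim ∘ out-of-range i
    ; column-smaller = λ i _ → ⊥-elim ∘ out-of-range i
    ; row-ascent     = row-ascent
    ; free-rlmin     = free-rlmin
    ; blocked-row    = λ _ ℓ _ → ⊥-elim ∘ out-of-range ℓ
    }
    where
    present⁺ : ∀ {a} → Present (suc n) a → a ∈ initWord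
    present⁺ (inj₁ (t , refl , t<r))                   = eps∈initWord t<r
    present⁺ (inj₂ (i , refl , inj₁ free))             = free∈initWord free
    present⁺ (inj₂ (i , refl , inj₂ (inj₁ (_ , n<i)))) = ⊥-elim (out-of-range i n<i)
    present⁺ (inj₂ (i , refl , inj₂ (inj₂ (ℓ , _ , n<ℓ)))) = ⊥-elim (out-of-range ℓ n<ℓ)
    free-rlmin : ∀ i → FreeRow R i → RLMin initWord (symOf i)
    free-rlmin i free = AllPairs-split initWord initWord-increasing (free∈initWord free)
    row-ascent : ∀ i → lookup w i ≡ L2 → Placed (suc n) i → RowAscent initWord i
    row-ascent i _ (inj₂ (inj₁ (_ , n<i)))       = ⊥-elim (out-of-range i n<i)
    row-ascent i _ (inj₂ (inj₂ (ℓ , _ , n<ℓ)))   = ⊥-elim (out-of-range ℓ n<ℓ)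
    row-ascent i _ (inj₁ free) with free-rlmin i free
    ... | xs , []     , e , _         = inj₁ (xs , e)
    ... | xs , y ∷ ys , e , (i<y ∷ _) with num<ˢ⁻ i<y
    ...   | k , refl , i<k = inj₂ (k , (xs , ys , e) , i<k)

  data TargetOf (ℓ : Strip) : Sym → Set where
    diagonal       : lookup w ℓ ≡ L1 → TargetOf ℓ (eps (diagIndex ℓ))
    up-in-row      : ∀ {h} → lookup w ℓ ≡ L0 → fill h ℓ ≡ up → lookup w h ≡ L2 → TargetOf ℓ (symOf h)
    up-in-diagonal : ∀ {h} → lookup w ℓ ≡ L0 → fill h ℓ ≡ up → lookup w h ≡ L1 → TargetOf ℓ (eps (diagIndex h))

  target-row : ∀ {ℓ} → lookup w ℓ ≡ L2 → target ℓ ≡ nothing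
  target-row wℓ rewrite wℓ = refl

  upTarget-target : ∀ {ℓ h} → lookup w ℓ ≡ L0 → fill h ℓ ≡ up → TargetOf ℓ (upTarget h)
  upTarget-target {ℓ} {h} wℓ hℓ with lookup w h in wh
  ... | L0 = ⊥-elim (proj₂ (proj₂ (up-cell hℓ)) wh)
  ... | L1 = up-in-diagonal wℓ hℓ wh
  ... | L2 = up-in-row wℓ hℓ wh

  target-found : ∀ ℓ → lookup w ℓ ≢ L2 → ∃[ t ] (target ℓ ≡ just t × TargetOf ℓ t)
  target-found ℓ ℓ≢row with lookup w ℓ in wℓ
  ... | L2 = ⊥-elim (ℓ≢row refl)
  ... | L1 = _ , refl , diagonal wℓ
  ... | L0 with firstUp-found wℓ
  ...   | h , first≡ , hℓ = _ , cong (Maybe.map upTarget) first≡ , upTarget-target wℓ hℓ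

  target-eps-not-after : ∀ {ℓ t d} → TargetOf ℓ t → t ≡ eps (diagIndex d) → lookup w d ≡ L1 → ¬ ℓ F.< d
  target-eps-not-after (diagonal _) e wd ℓ<d = <-irrefl (eps-injective e) (diagIndex-strict ℓ<d wd)
  target-eps-not-after (up-in-row _ _ _) ()
  target-eps-not-after (up-in-diagonal _ hℓ _) e wd ℓ<d =
    <-irrefl (eps-injective e) (diagIndex-strict (<-trans (proj₁ (proj₂ (up-cell hℓ))) ℓ<d) wd)

  free-or-not : ∀ h → FreeRow R h ⊎ lookup w h ≢ L2 ⊎ ∃[ c ] (fill h c ≡ left)
  free-or-not h with lookup w h ≟L L2
  ... | no h≢row = inj₂ (inj₁ h≢row)
  ... | yes h-row with F.any? (λ c → fill h c ≟A left)
  ...   | yes has-left = inj₂ (inj₂ has-left)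
  ...   | no no-left   = inj₁ (h-row , λ c hc → no-left (c , hc))

  -- A row holding the up-arrow of ℓ has its left-arrow (if any) in a column after ℓ, processed earlier.
  target-present : ∀ {ℓ t} → TargetOf ℓ t → Present (suc (toℕ ℓ)) t
  target-present {ℓ} (diagonal _)                = inj₁ (InitialEps-diagIndex ℓ)
  target-present (up-in-diagonal {h} _ _ _)      = inj₁ (InitialEps-diagIndex h)
  target-present (up-in-row {h} _ hℓ wh) with free-or-not h
  ... | inj₁ free            = inj₂ (h , refl , inj₁ free)
  ... | inj₂ (inj₁ h≢row)    = ⊥-elim (h≢row wh)
  ... | inj₂ (inj₂ (c , hc)) = inj₂ (h , refl , inj₂ (inj₂ (c , hc , up-east-of-left hℓ hc)))

  diagonal-target : ∀ {ℓ t} → TargetOf ℓ t → lookup w ℓ ≡ L1 → t ≡ eps (diagIndex ℓ)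
  diagonal-target (diagonal _)              _  = refl
  diagonal-target (up-in-row wℓ _ _)        wℓ' = contradiction (trans (sym wℓ) wℓ') λ ()
  diagonal-target (up-in-diagonal wℓ _ _)   wℓ' = contradiction (trans (sym wℓ) wℓ') λ ()

  column-target : ∀ {ℓ t} → TargetOf ℓ t → lookup w ℓ ≡ L0 → ColumnSuccessor (toℕ ℓ) ℓ t
  column-target (diagonal wℓ)              wℓ' = contradiction (trans (sym wℓ') wℓ) λ ()
  column-target (up-in-row _ hℓ _)         _   = inj₁ (_ , refl , s≤s (proj₁ (proj₂ (up-cell hℓ))))
  column-target (up-in-diagonal _ hℓ wh)   _   = inj₂ (_ , refl , wh , proj₁ (proj₂ (up-cell hℓ)))

  target-not-above-left : ∀ {ℓ t i} → TargetOf ℓ t → fill i ℓ ≡ left → ¬ (symOf i <ˢ t)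
  target-not-above-left (diagonal _)           _  ()
  target-not-above-left (up-in-diagonal _ _ _) _  ()
  target-not-above-left (up-in-row _ hℓ wh)    iℓ (nn i<h) = <-asym (up-north-of-left hℓ wh iℓ) (≤-pred i<h)

  block-above-target : ∀ {ℓ t k} → TargetOf ℓ t → t ≡ num k → All (num k <ˢ_) (block ℓ)
  block-above-target (diagonal _)           ()
  block-above-target (up-in-diagonal _ _ _) ()
  block-above-target {ℓ} (up-in-row {h} _ hℓ wh) refl = All.tabulate above
    where
    above : ∀ {b} → b ∈ block ℓ → symOf h <ˢ b
    above b∈ with ∈-block⁻ b∈
    ... | inj₁ (i , refl , iℓ) = nn (s≤s (up-north-of-left hℓ wh iℓ))
    ... | inj₂ refl            = nn (s≤s (proj₁ (proj₂ (up-cell hℓ))))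

  block-≤ : ∀ {ℓ b} → b ∈ block ℓ → ∃[ k ] (b ≡ num k × k ≤ label ℓ)
  block-≤ b∈ with ∈-block⁻ b∈
  ... | inj₁ (i , refl , iℓ) = _ , refl , <⇒≤ (s≤s (proj₁ (proj₂ (left-cell iℓ))))
  ... | inj₂ refl            = _ , refl , ≤-refl

  block-head : ∀ ℓ → ∃[ b ] ∃[ B ] (block ℓ ≡ b ∷ B)
  block-head ℓ with leftLabels ℓ
  ... | []    = _ , _ , refl
  ... | _ ∷ _ = _ , _ , refl

  Placed-split : ∀ {i ℓ} → Placed (toℕ ℓ) i →
    Placed (suc (toℕ ℓ)) i ⊎ fill i ℓ ≡ left ⊎ (i ≡ ℓ × lookup w ℓ ≢ L2)
  Placed-split (inj₁ free) = inj₁ (inj₁ free)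
  Placed-split (inj₂ (inj₁ (i≢row , ℓ≤i))) with m≤n⇒m<n∨m≡n ℓ≤i
  ... | inj₁ ℓ<i = inj₁ (inj₂ (inj₁ (i≢row , ℓ<i)))
  ... | inj₂ ℓ≡i with F.toℕ-injective ℓ≡i
  ...   | refl = inj₂ (inj₂ (refl , i≢row))
  Placed-split (inj₂ (inj₂ (ℓ' , iℓ' , ℓ≤ℓ'))) with m≤n⇒m<n∨m≡n ℓ≤ℓ'
  ... | inj₁ ℓ<ℓ' = inj₁ (inj₂ (inj₂ (ℓ' , iℓ' , ℓ<ℓ')))
  ... | inj₂ ℓ≡ℓ' with F.toℕ-injective ℓ≡ℓ'
  ...   | refl = inj₂ (inj₁ iℓ')

  Placed-weaken : ∀ {p i} → Placed (suc p) i → Placed p i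
  Placed-weaken (inj₁ free)                   = inj₁ free
  Placed-weaken (inj₂ (inj₁ (i≢row , p<i)))   = inj₂ (inj₁ (i≢row , <⇒≤ p<i))
  Placed-weaken (inj₂ (inj₂ (ℓ , iℓ , p<ℓ))) = inj₂ (inj₂ (ℓ , iℓ , <⇒≤ p<ℓ))

  Present-weaken : ∀ {p a} → Present (suc p) a → Present p a
  Present-weaken = Sum.map₂ (λ { (i , a≡ , placed) → i , a≡ , Placed-weaken placed })

  block-fresh : ∀ {ℓ v} → lookup w ℓ ≢ L2 → Invariant (suc (toℕ ℓ)) v → ∀ {b} → b ∈ block ℓ → b ∉ v
  block-fresh {ℓ} ℓ≢row I b∈ b∈v with Invariant.present⁻ I b∈v | ∈-block⁻ b∈
  ... | inj₁ (_ , () , _) | inj₁ (_ , refl , _)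
  ... | inj₁ (_ , () , _) | inj₂ refl
  ... | inj₂ (i , b≡ , placed) | inj₁ (i' , refl , i'ℓ) with symOf-injective b≡
  ...   | refl with placed
  ...     | inj₁ (_ , no-left)              = no-left ℓ i'ℓ
  ...     | inj₂ (inj₁ (i≢row , _))         = i≢row (proj₁ (left-cell i'ℓ))
  ...     | inj₂ (inj₂ (ℓ' , iℓ' , ℓ<ℓ')) with left-unique i'ℓ iℓ'
  ...       | refl = <-irrefl refl ℓ<ℓ'
  block-fresh {ℓ} ℓ≢row I b∈ b∈v | inj₂ (i , b≡ , placed) | inj₂ refl with symOf-injective b≡
  ...   | refl with placed
  ...     | inj₁ (i-row , _)                = ℓ≢row i-row
  ...     | inj₂ (inj₁ (_ , ℓ<ℓ))           = <-irrefl refl ℓ<ℓ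
  ...     | inj₂ (inj₂ (ℓ' , ℓℓ' , _))      = ℓ≢row (proj₁ (left-cell ℓℓ'))

  module InsertStep {ℓ t} (P Q : List Sym) (ℓ≢row : lookup w ℓ ≢ L2) (tgt : TargetOf ℓ t)
                    (I : Invariant (suc (toℕ ℓ)) (P ++ t ∷ Q)) where
    open BlockInsertion P (block ℓ) t Q
    private module I = Invariant I

    present⁻ : ∀ {a} → a ∈ v' → Present (toℕ ℓ) a
    present⁻ a∈ with ∈-inserted⁻ a∈
    ... | inj₁ a∈v = Present-weaken (I.present⁻ a∈v)
    ... | inj₂ a∈block with ∈-block⁻ a∈block
    ...   | inj₁ (i , refl , iℓ) = inj₂ (i , refl , inj₂ (inj₂ (ℓ , iℓ , ≤-refl)))
    ...   | inj₂ refl            = inj₂ (ℓ , refl , inj₂ (inj₁ (ℓ≢row , ≤-refl)))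

    present⁺ : ∀ {a} → Present (toℕ ℓ) a → a ∈ v'
    present⁺ (inj₁ initial) = ∈-original⁺ (I.present⁺ (inj₁ initial))
    present⁺ (inj₂ (i , refl , placed)) with Placed-split placed
    ... | inj₁ placed'           = ∈-original⁺ (I.present⁺ (inj₂ (i , refl , placed')))
    ... | inj₂ (inj₁ iℓ)         = ∈-block⁺ (∈-++⁺ˡ (∈-leftLabels⁺ iℓ))
    ... | inj₂ (inj₂ (refl , _)) = ∈-block⁺ (∈-++⁺ʳ (leftLabels ℓ) (here refl))

    unique : Unique v'
    unique = unique-inserted I.unique (AllPairs.map <ˢ⇒≢ (block-increasing ℓ)) (block-fresh ℓ≢row I)

    b₀ : Sym
    b₀ = proj₁ (block-head ℓ)

    block≡ : block ℓ ≡ b₀ ∷ proj₁ (proj₂ (block-head ℓ))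
    block≡ = proj₂ (proj₂ (block-head ℓ))

    b₀∈block : b₀ ∈ block ℓ
    b₀∈block = subst (b₀ ∈_) (sym block≡) (here refl)

    ℓ-then-target : Adjacent v' (symOf ℓ) t
    ℓ-then-target = adjacent-last P (leftLabels ℓ) (symOf ℓ) t Q

    diagonal-eps : ∀ i → lookup w i ≡ L1 → toℕ ℓ ≤ toℕ i → Adjacent v' (symOf i) (eps (diagIndex i))
    diagonal-eps i wi ℓ≤i with m≤n⇒m<n∨m≡n ℓ≤i
    ... | inj₂ ℓ≡i with F.toℕ-injective ℓ≡i
    ...   | refl = subst (Adjacent v' (symOf ℓ)) (diagonal-target tgt wi) ℓ-then-target
    diagonal-eps i wi ℓ≤i | inj₁ ℓ<i with adjacent-preserved block≡ I.unique (I.diagonal-eps i wi ℓ<i)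
    ...   | inj₁ (eps≡t , _) = ⊥-elim (target-eps-not-after tgt (sym eps≡t) wi ℓ<i)
    ...   | inj₂ (_ , adj)   = adj

    column-smaller : ∀ i → lookup w i ≡ L0 → toℕ ℓ ≤ toℕ i →
      ∃[ y ] (Adjacent v' (symOf i) y × ColumnSuccessor (toℕ ℓ) i y)
    column-smaller i wi ℓ≤i with m≤n⇒m<n∨m≡n ℓ≤i
    ... | inj₂ ℓ≡i with F.toℕ-injective ℓ≡i
    ...   | refl = t , ℓ-then-target , column-target tgt wi
    column-smaller i wi ℓ≤i | inj₁ ℓ<i with I.column-smaller i wi ℓ<i
    ... | y , adj , succ with adjacent-preserved block≡ I.unique adj | succ
    ...   | inj₁ (_ , adj') | _ with block-≤ b₀∈block
    ...     | k , b₀≡ , k≤ℓ = b₀ , adj' , inj₁ (k , b₀≡ , ≤-<-trans k≤ℓ (s≤s ℓ<i))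
    column-smaller i wi ℓ≤i | inj₁ ℓ<i | y , adj , succ | inj₂ (_ , adj') | inj₁ smaller = y , adj' , inj₁ smaller
    column-smaller i wi ℓ≤i | inj₁ ℓ<i | y , adj , succ | inj₂ (y≢t , adj') | inj₂ (h , y≡ , wh , h<ℓ+1)
      with m≤n⇒m<n∨m≡n (≤-pred h<ℓ+1)
    ...   | inj₁ h<ℓ = y , adj' , inj₂ (h , y≡ , wh , h<ℓ)
    ...   | inj₂ h≡ℓ with F.toℕ-injective h≡ℓ
    ...     | refl = ⊥-elim (y≢t (trans y≡ (sym (diagonal-target tgt wh))))

    row-ascent : ∀ i → lookup w i ≡ L2 → Placed (toℕ ℓ) i → RowAscent v' i
    row-ascent i wi placed with Placed-split placed
    ... | inj₂ (inj₂ (refl , i≢row)) = ⊥-elim (i≢row wi)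
    ... | inj₂ (inj₁ iℓ)
      with adjacent-in-sorted <ˢ-irrefl P (leftLabels ℓ) (symOf ℓ) (t ∷ Q) (block-increasing ℓ) (∈-leftLabels⁺ iℓ)
    ...   | y , adj , i<y with num<ˢ⁻ i<y
    ...     | k , refl , i<k = inj₂ (k , adj , i<k)
    row-ascent i wi placed | inj₁ placed' with I.row-ascent i wi placed'
    ... | inj₁ last = inj₁ (isLast-preserved last)
    ... | inj₂ (k , adj , i<k) with adjacent-preserved block≡ I.unique adj
    ...   | inj₂ (_ , adj') = inj₂ (k , adj' , i<k)
    ...   | inj₁ (k≡t , adj') with num<ˢ⁻ (All.lookup (block-above-target tgt (sym k≡t)) b₀∈block)
    ...     | k' , b₀≡ , k<k' = inj₂ (k' , subst (Adjacent v' (symOf i)) b₀≡ adj' , <-trans i<k k<k')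

    free-rlmin : ∀ i → FreeRow R i → RLMin v' (symOf i)
    free-rlmin i free with I.free-rlmin i free
    ... | xs , ys , v≡ , i<ys with split-preserved v≡
    ...   | inj₁ (xs' , v'≡) = xs' , ys , v'≡ , i<ys
    ...   | inj₂ (P' , ys≡ , v'≡) =
      xs , _ , v'≡ , All.++⁺ (All.++⁻ˡ P' i<P'tQ) (All.++⁺ i<block (All.++⁻ʳ P' i<P'tQ))
      where
      i<P'tQ : All (symOf i <ˢ_) (P' ++ t ∷ Q)
      i<P'tQ = subst (All (symOf i <ˢ_)) ys≡ i<ys
      -- Here t is a row label, and the whole block of ℓ lies above it.
      i<block : All (symOf i <ˢ_) (block ℓ)
      i<block with All.++⁻ʳ P' i<P'tQ
      ... | i<t ∷ _ with num<ˢ⁻ i<t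
      ...   | k , t≡ , _ = All.map (<ˢ-trans i<t) (subst (λ z → All (z <ˢ_) (block ℓ)) (sym t≡) (block-above-target tgt t≡))

    blocked-row : ∀ i ℓ' → fill i ℓ' ≡ left → toℕ ℓ ≤ toℕ ℓ' →
      ∃[ y ] (Precedes v' (symOf i) y × ¬ (symOf i <ˢ y))
    blocked-row i ℓ' iℓ' ℓ≤ℓ' with m≤n⇒m<n∨m≡n ℓ≤ℓ'
    ... | inj₁ ℓ<ℓ' with I.blocked-row i ℓ' iℓ' ℓ<ℓ'
    ...   | y , prec , i≮y = y , precedes-preserved prec , i≮y
    blocked-row i ℓ' iℓ' ℓ≤ℓ' | inj₂ ℓ≡ℓ' with F.toℕ-injective ℓ≡ℓ'
    ...   | refl = t , precedes-from-block P (block ℓ) t Q (∈-++⁺ˡ (∈-leftLabels⁺ iℓ')) , target-not-above-left tgt iℓ'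

    invariant : Invariant (toℕ ℓ) v'
    invariant = record
      { present⁻ = present⁻ ; present⁺ = present⁺ ; unique = unique ; diagonal-eps = diagonal-eps
      ; column-smaller = column-smaller ; row-ascent = row-ascent ; free-rlmin = free-rlmin ; blocked-row = blocked-row }

  row-step : ∀ {ℓ v} → lookup w ℓ ≡ L2 → Invariant (suc (toℕ ℓ)) v → Invariant (toℕ ℓ) v
  row-step {ℓ} {v} wℓ I = record
    { present⁻       = Present-weaken ∘ I.present⁻
    ; present⁺       = Sum.[ I.present⁺ ∘ inj₁ , (λ { (i , a≡ , placed) → I.present⁺ (inj₂ (i , a≡ , lift placed)) }) ]
    ; unique         = I.unique
    ; diagonal-eps   = λ i wi ℓ≤i → I.diagonal-eps i wi (≤∧≢⇒< ℓ≤i (ℓ≢ (diagonal-not-row wi)))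
    ; column-smaller = column-smaller
    ; row-ascent     = λ i wi placed → I.row-ascent i wi (lift placed)
    ; free-rlmin     = I.free-rlmin
    ; blocked-row    = λ i ℓ' iℓ' ℓ≤ℓ' →
        I.blocked-row i ℓ' iℓ' (≤∧≢⇒< ℓ≤ℓ' (ℓ≢ (proj₂ (proj₂ (left-cell iℓ')))))
    }
    where
    module I = Invariant I
    ℓ≢ : ∀ {i} → lookup w i ≢ L2 → toℕ ℓ ≢ toℕ i
    ℓ≢ i≢row ℓ≡i with F.toℕ-injective ℓ≡i
    ... | refl = i≢row wℓ
    lift : ∀ {i} → Placed (toℕ ℓ) i → Placed (suc (toℕ ℓ)) i
    lift placed with Placed-split placed
    ... | inj₁ placed'               = placed'
    ... | inj₂ (inj₁ iℓ)             = ⊥-elim (proj₂ (proj₂ (left-cell iℓ)) wℓ)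
    ... | inj₂ (inj₂ (refl , ℓ≢row)) = ⊥-elim (ℓ≢row wℓ)
    column-smaller : ∀ i → lookup w i ≡ L0 → toℕ ℓ ≤ toℕ i →
      ∃[ y ] (Adjacent v (symOf i) y × ColumnSuccessor (toℕ ℓ) i y)
    column-smaller i wi ℓ≤i with I.column-smaller i wi (≤∧≢⇒< ℓ≤i (ℓ≢ (column-not-row wi)))
    ... | y , adj , inj₁ smaller               = y , adj , inj₁ smaller
    ... | y , adj , inj₂ (h , y≡ , wh , h<ℓ+1) =
      y , adj , inj₂ (h , y≡ , wh , ≤∧≢⇒< (≤-pred h<ℓ+1) (ℓ≢ (diagonal-not-row wh) ∘ sym))

  step-row : ∀ {ℓ} v → lookup w ℓ ≡ L2 → step v ℓ ≡ v
  step-row v wℓ rewrite target-row wℓ = refl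

  step-target : ∀ {ℓ t} v → target ℓ ≡ just t → step v ℓ ≡ insertBefore t (block ℓ) v
  step-target v target≡ rewrite target≡ = refl

  step-invariant : ∀ {v} ℓ → Invariant (suc (toℕ ℓ)) v → Invariant (toℕ ℓ) (step v ℓ)
  step-invariant {v} ℓ I with lookup w ℓ ≟L L2
  ... | yes wℓ = subst (Invariant (toℕ ℓ)) (sym (step-row v wℓ)) (row-step wℓ I)
  ... | no ℓ≢row with target-found ℓ ℓ≢row
  ...   | t , target≡ , tgt with insertBefore-split t (block ℓ) v (Invariant.present⁺ I (target-present tgt))
  ...     | P , Q , v≡ , ins≡ =
    subst (Invariant (toℕ ℓ)) (sym (trans (step-target v target≡) ins≡))
          (InsertStep.invariant P Q ℓ≢row tgt (subst (Invariant (suc (toℕ ℓ))) v≡ I))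

  data UpFrom : ℕ → List Strip → Set where
    []  : UpFrom (suc n) []
    cons : ∀ {p x xs} → toℕ x ≡ p → UpFrom (suc p) xs → UpFrom p (x ∷ xs)

  foldr-invariant : ∀ {p xs} → UpFrom p xs → Invariant p (foldr (λ ℓ v → step v ℓ) initWord xs)
  foldr-invariant []               = initial-invariant
  foldr-invariant (cons refl rest) = step-invariant _ (foldr-invariant rest)

  UpFrom-tabulate : ∀ k (f : Fin k → Strip) p → (∀ i → toℕ (f i) ≡ p + toℕ i) → p + k ≡ suc n → UpFrom p (tabulate f)
  UpFrom-tabulate zero    f p f≡ p≡ rewrite +-identityʳ p = subst (λ q → UpFrom q []) (sym p≡) []
  UpFrom-tabulate (suc k) f p f≡ p≡ =
    cons (trans (f≡ F.zero) (+-identityʳ p))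
         (UpFrom-tabulate k (f ∘ F.suc) (suc p) (λ i → trans (f≡ (F.suc i)) (+-suc p (toℕ i))) (trans (sym (+-suc p k)) p≡))

  foldl-skip-rows : ∀ v xs → foldl step v (filterᵇ (λ ℓ → not (isYes (lookup w ℓ ≟L L2))) xs) ≡ foldl step v xs
  foldl-skip-rows v []       = refl
  foldl-skip-rows v (x ∷ xs) with lookup w x ≟L L2
  ... | yes wx = trans (foldl-skip-rows v xs) (cong (λ v' → foldl step v' xs) (sym (step-row v wx)))
  ... | no _   = foldl-skip-rows (step v x) xs

  final-invariant : Invariant 0 word
  final-invariant = subst (Invariant 0) (sym word≡) (foldr-invariant (UpFrom-tabulate (suc n) (λ i → i) 0 (λ _ → refl) refl))
    where
    word≡ : word ≡ foldr (λ ℓ v → step v ℓ) initWord (allFin (suc n))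
    word≡ = trans (foldl-skip-rows initWord (reverse (allFin (suc n)))) (reverse-foldl step initWord (allFin (suc n)))

-- Reading off the type of each letter

module ReadOff {n r : ℕ} (R : RATplus n r) where
  open RATplus R
  open RATFacts R
  open InsertionInvariant R
  private module I = Invariant final-invariant

  v : List Sym
  v = phiWord R

  -- Every letter occurs once in v, so any two splittings at the same letter agree.
  adjacent-at : ∀ {a y xs ys} → Adjacent v a y → v ≡ xs ++ a ∷ ys → ∃[ zs ] (ys ≡ y ∷ zs)
  adjacent-at {xs = xs} {ys} (xs' , zs , e') e =
    zs , sym (proj₂ (Unique-position xs' xs ys (subst Unique e' I.unique) (trans (sym e') e)))

  isLast-at : ∀ {a xs ys} → IsLast v a → v ≡ xs ++ a ∷ ys → ys ≡ []
  isLast-at {xs = xs} {ys} (xs' , e') e = sym (proj₂ (Unique-position xs' xs ys (subst Unique e' I.unique) (trans (sym e') e)))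

  precedes-at : ∀ {a y xs ys} → Precedes v a y → v ≡ xs ++ a ∷ ys → y ∈ ys
  precedes-at {y = y} {xs} {ys} (xs' , ys' , e' , y∈) e =
    subst (y ∈_) (proj₂ (Unique-position xs' xs ys (subst Unique e' I.unique) (trans (sym e') e))) y∈

  column-then-smaller : ∀ i → lookup w i ≡ L0 → ∃[ k ] (Adjacent v (symOf i) (num k) × k < label i)
  column-then-smaller i wi with I.column-smaller i wi z≤n
  ... | y , adj , inj₁ (k , refl , k<i) = k , adj , k<i
  ... | y , adj , inj₂ (_ , _ , _ , ())

  row-ascent : ∀ i → lookup w i ≡ L2 → RowAscent v i
  row-ascent i wi with free-or-not i
  ... | inj₁ free             = I.row-ascent i wi (inj₁ free)
  ... | inj₂ (inj₁ i≢row)     = I.row-ascent i wi (inj₂ (inj₁ (i≢row , z≤n)))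
  ... | inj₂ (inj₂ (c , ic))  = I.row-ascent i wi (inj₂ (inj₂ (c , ic , z≤n)))

  diagonal⇔special-descent : ∀ i → (lookup w i ≡ L1) ⇔ SpecialDescent v (label i)
  diagonal⇔special-descent i = mk⇔ to from
    where
    to : lookup w i ≡ L1 → SpecialDescent v (label i)
    to wi with I.diagonal-eps i wi z≤n
    ... | xs , zs , e = xs , _ , zs , e , en , (_ , refl)
    from : SpecialDescent v (label i) → lookup w i ≡ L1
    from (xs , _ , zs , e , _ , (t , refl)) with lookup w i in wi
    ... | L1 = refl
    ... | L0 with column-then-smaller i wi
    ...   | k , adj , _ with adjacent-at adj e
    ...     | _ , ()
    from (xs , _ , zs , e , _ , (t , refl)) | L2 with row-ascent i wi
    ...   | inj₁ last with isLast-at last e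
    ...     | ()
    from (xs , _ , zs , e , _ , (t , refl)) | L2 | inj₂ (k , adj , _) with adjacent-at adj e
    ...     | _ , ()

  row⇔ascent : ∀ i → (lookup w i ≡ L2) ⇔ Ascent v (label i)
  row⇔ascent i = mk⇔ to from
    where
    to : lookup w i ≡ L2 → Ascent v (label i)
    to wi with row-ascent i wi
    ... | inj₁ (xs , e)                      = xs , [] , e , inj₁ refl
    ... | inj₂ (k , (xs , zs , e) , i<k)    = xs , _ , e , inj₂ (_ , zs , refl , nn i<k)
    from : Ascent v (label i) → lookup w i ≡ L2
    from (xs , ys , e , asc) with lookup w i in wi
    ... | L2 = refl
    ... | L1 with adjacent-at (I.diagonal-eps i wi z≤n) e | asc
    ...   | _ , refl | inj₁ ()
    ...   | _ , refl | inj₂ (_ , _ , refl , ())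
    from (xs , ys , e , asc) | L0 with column-then-smaller i wi
    ...   | k , adj , k<i with adjacent-at adj e | asc
    ...     | _ , refl | inj₁ ()
    ...     | _ , refl | inj₂ (_ , _ , refl , nn i<k) = ⊥-elim (<-asym k<i i<k)

  column⇔regular-descent : ∀ i → (lookup w i ≡ L0) ⇔ RegularDescent v (label i)
  column⇔regular-descent i = mk⇔ to from
    where
    to : lookup w i ≡ L0 → RegularDescent v (label i)
    to wi with column-then-smaller i wi
    ... | k , (xs , zs , e) , k<i = xs , num k , zs , e , nn k<i , λ { (_ , ()) }
    from : RegularDescent v (label i) → lookup w i ≡ L0
    from (xs , y , zs , e , y<i , not-eps) with lookup w i in wi
    ... | L0 = refl
    ... | L1 with adjacent-at (I.diagonal-eps i wi z≤n) e
    ...   | _ , refl = ⊥-elim (not-eps (_ , refl))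
    from (xs , y , zs , e , y<i , not-eps) | L2 with row-ascent i wi
    ...   | inj₁ last with isLast-at last e
    ...     | ()
    from (xs , y , zs , e , y<i , not-eps) | L2 | inj₂ (k , adj , i<k) with adjacent-at adj e | y<i
    ...     | _ , refl | nn k<i = ⊥-elim (<-asym i<k k<i)

  rlmin⇔free-row : ∀ k → RLMin v (num k) ⇔ (∃[ i ] (k ≡ label i × FreeRow R i))
  rlmin⇔free-row k = mk⇔ to from
    where
    from : ∃[ i ] (k ≡ label i × FreeRow R i) → RLMin v (num k)
    from (i , refl , free) = I.free-rlmin i free
    to : RLMin v (num k) → ∃[ i ] (k ≡ label i × FreeRow R i)
    to (xs , ys , e , k<ys) with I.present⁻ (subst (num k ∈_) (sym e) (∈-++⁺ʳ xs (here refl)))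
    ... | inj₁ (_ , () , _)
    ... | inj₂ (i , refl , _) with free-or-not i
    ...   | inj₁ free = i , refl , free
    ...   | inj₂ (inj₂ (c , ic)) with I.blocked-row i c ic z≤n
    ...     | y , prec , i≮y = ⊥-elim (i≮y (All.lookup k<ys (precedes-at prec e)))
    to (xs , ys , e , k<ys) | inj₂ (i , refl , _) | inj₂ (inj₁ i≢row) with lookup w i in wi
    ...     | L2 = ⊥-elim (i≢row refl)
    ...     | L1 with adjacent-at (I.diagonal-eps i wi z≤n) e
    ...       | _ , refl with k<ys
    ...         | () ∷ _
    to (xs , ys , e , k<ys) | inj₂ (i , refl , _) | inj₂ (inj₁ i≢row) | L0 with column-then-smaller i wi
    ...       | k' , adj , k'<i with adjacent-at adj e
    ...         | _ , refl with k<ys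
    ...           | nn i<k' ∷ _ = ⊥-elim (<-asym k'<i i<k')

lemma4p6 : (n r : ℕ) → r ≤ n → (R : RATplus n r) →
    (∀ (i : Fin (suc n)) → toℕ i ≢ 0 →
        ((lookup (RATplus.w R) i ≡ L1) ⇔ SpecialDescent (phiWord R) (label i))
      × ((lookup (RATplus.w R) i ≡ L2) ⇔ Ascent (phiWord R) (label i))
      × ((lookup (RATplus.w R) i ≡ L0) ⇔ RegularDescent (phiWord R) (label i)))
    × (∀ (k : ℕ) → RLMin (phiWord R) (num k) ⇔ (∃[ i ] (k ≡ label i × FreeRow R i)))
lemma4p6 n r _ R =
  (λ i _ → diagonal⇔special-descent i , row⇔ascent i , column⇔regular-descent i) , rlmin⇔free-row
  where open ReadOff R
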